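{- Let $L$ be an algebraic language with term category $\mathbf{L}$ and generic $L$-structure $G$ in $\mathbf{L}$. For every monoidal category $\mathbf{C}$, the functor $\hom(\mathbf{L},\mathbf{C})\to\mathrm{Str}(L,\mathbf{C})$ given by evaluation at $G$ (sending a strong monoidal functor $F$ to the induced $L$-structure $FG$) is an equivalence of categories; thus $\mathbf{L}$ is a classifying category for $L$-structures.
   Context: Algebraic languages: fix a finitary many-sorted signature $\Sigma$ (atomic types; functional constants $f\colon B_1,\dots,B_n\to B_{n+1}$). Types are finite sequences of atomic types (juxtaposition; $\emptyset$ empty). Raw terms: $t::=\emptyset\mid x\mid f(t_1,\dots,t_n)\mid tt$, tensor associative with unit $\emptyset$; $t[s/x]$ denotes simultaneous substitution of $s=s_1\dots s_n$ for distinct atomic variables $x=x_1\dots x_n$. Sequents $x:A\vdash t:B$ with $x$ distinct atomic variables. Term calculus: Variables $x:A\vdash x:A$ ($x,A$ atomic); Functions: from $x_i:A_i\vdash t_i:B_i$ infer $x_1\dots x_n:A_1\dots A_n\vdash f(t_1,\dots,t_n):B_{n+1}$; Substitution: from $x:A\vdash s:B$, $y:B\vdash t:C$ infer $x:A\vdash t[s/y]:C$; Unit $\emptyset:\emptyset\vdash\emptyset:\emptyset$; Tensor: from $x:A\vdash s:B$, $y:C\vdash t:D$ infer $xy:AC\vdash st:BD$; Weakening: from $x_1x_3:A_1A_3\vdash t:B$ infer $x_1x_2x_3:A_1A_2A_3\vdash t:B$; Exchange: from $x:A\vdash t:B$ infer $\sigma x:\sigma A\vdash t:B$; Contraction: from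 $x_1xx'x_2:A_1AAA_2\vdash t:B$ infer $x_1xx_2:A_1AA_2\vdash t[x/x']:B$. An algebraic language $L$ is $\Sigma$ plus a subset of {weakening, exchange, contraction}; its terms are the sequents derivable with all non-structural rules and its structural rules. Structures: in a monoidal category $\mathbf{C}$ (coherence isomorphisms inserted where needed), an $L$-prestructure assigns objects $|A|$ to atomic types (extended to types by tensor, $|\emptyset|=1$), arrows $|f|\colon|B_1|\dots|B_n|\to|B_{n+1}|$, and for the structural rules of $L$ arrows $\pi_A\colon|A|\to1$, $\sigma_A\colon|\sigma A|\to|A|$, $\Delta_A\colon|A|\to|AA|$ for all types $A$. Derivations are interpreted inductively (variables $\mapsto$ identities, functions $\mapsto$ tensor of interpretations followed by $|f|$, substitution $\mapsto$ composition, unit $\mapsto$ identity of 1, tensor $\mapsto$ tensor, weakening/exchange/contraction $\mapsto$ precomposition with $1\pi_A1$, $\sigma_A$, $1\Delta_A1$). An $L$-structure is a prestructure whose interpretation of terms is independent of derivations. A morphism $h\colon M\to N$ consists of arrows $h_A\colon|A|_M\to|A|_N$ ($A$ atomic, extended by tensor) with $h_A\cdot|t|_N=|t|_M\cdot h_B$ for every term $x:A\vdash t:B$ (composition written diagrammatically). $\mathrm{Str}(L,\mathbf{C})$ is the resulting category. A strong monoidal functor $F\colon\mathbf{L}\to\mathbf{C}$ transports an $L$-structure $M$ to $FM$ by applying $F$ and correcting domains/codomains with the coherence isomorphisms of $F$; a monoidal natural transformation $k\colon F\to F'$ gives the morphism with components $k_{|A|_M}$. $\hom(\mathbf{L},\mathbf{C})$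 is the category of strong monoidal functors and monoidal natural transformations. Term category: terms $x:A\vdash s:B$ and $y:A\vdash t:B$ are alphabetical variants if $s[z/x]=t[z/y]$ for some variable $z:A$. $\mathbf{L}$ has types as objects, terms modulo alphabetical variance as arrows, composition of $x:A\vdash s:B$ and $y:B\vdash t:C$ given by $x:A\vdash t[s/y]:C$, identities $x:A\vdash x:A$, and strict monoidal tensor given by concatenation of types and the tensor of terms. The generic $L$-structure $G$ in $\mathbf{L}$: $|A|=A$, $|f|=(x_1\dots x_n:B_1\dots B_n\vdash f(x_1,\dots,x_n):B_{n+1})$, $\pi_A=(x:A\vdash\emptyset:\emptyset)$, $\sigma_A=(\sigma x:\sigma A\vdash x:A)$, $\Delta_A=(x:A\vdash xx:AA)$. -}

module Defs where

open import Level using (Level; _⊔_) renaming (suc to lsuc; zero to lzero)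
open import Data.Bool using (Bool; true; false; T)
open import Data.Nat using (ℕ; zero; suc; _+_; _<_; _≤_; _≟_)
open import Data.Nat.Properties using (<⇒≢; <-≤-trans; suc-injective; ≤-refl; ≤-trans; n≤1+n; +-suc)
open import Data.Fin using (Fin; toℕ)
open import Data.List using (List; []; _∷_; _++_; length; map; [_])
open import Data.List.Properties using (++-identityʳ; ++-assoc)
open import Data.List.Relation.Unary.All using (All; []; _∷_)
import Data.List.Relation.Unary.All as All
import Data.List.Relation.Unary.All.Properties as AllP
open import Data.List.Relation.Unary.AllPairs using ([]; _∷_)
open import Data.List.Relation.Unary.Unique.Propositional using (Unique)
open import Data.Product using (Σ; _,_; _×_; proj₁; proj₂)
open import Data.Unit using (⊤; tt)
open import Data.Empty using (⊥; ⊥-elim)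
open import Relation.Nullary using (yes; no; ¬_)
open import Relation.Binary.Structures using (IsEquivalence)
open import Relation.Binary.PropositionalEquality
  using (_≡_; _≢_; refl; sym; trans; cong; cong₂; subst)

-- Part 1.  Categories with hom-setoids, functors, equivalences

-- Composition is written diagrammatically:  f ⨾ g  means "first f, then g".
record Category (o ℓ e : Level) : Set (lsuc (o ⊔ ℓ ⊔ e)) where
  infix  4 _≈_ _⇒_
  infixr 9 _⨾_
  field
    Obj    : Set o
    _⇒_    : Obj → Obj → Set ℓ
    _≈_    : ∀ {A B} → A ⇒ B → A ⇒ B → Set e
    id     : ∀ {A} → A ⇒ A
    _⨾_    : ∀ {A B C} → A ⇒ B → B ⇒ C → A ⇒ C
    equiv  : ∀ {A B} → IsEquivalence (_≈_ {A} {B})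
    ⨾-resp : ∀ {A B C} {f f' : A ⇒ B} {g g' : B ⇒ C} →
             f ≈ f' → g ≈ g' → f ⨾ g ≈ f' ⨾ g'
    assoc  : ∀ {A B C D} {f : A ⇒ B} {g : B ⇒ C} {h : C ⇒ D} →
             (f ⨾ g) ⨾ h ≈ f ⨾ (g ⨾ h)
    idˡ    : ∀ {A B} {f : A ⇒ B} → id ⨾ f ≈ f
    idʳ    : ∀ {A B} {f : A ⇒ B} → f ⨾ id ≈ f

  module Eq {A B : Obj} = IsEquivalence (equiv {A} {B})

record Functor {o ℓ e o' ℓ' e'} (𝒞 : Category o ℓ e) (𝒟 : Category o' ℓ' e')
       : Set (o ⊔ ℓ ⊔ e ⊔ o' ⊔ ℓ' ⊔ e') where
  private
    module 𝒞 = Category 𝒞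
    module 𝒟 = Category 𝒟
  field
    F₀    : 𝒞.Obj → 𝒟.Obj
    F₁    : ∀ {A B} → A 𝒞.⇒ B → F₀ A 𝒟.⇒ F₀ B
    resp  : ∀ {A B} {f g : A 𝒞.⇒ B} → f 𝒞.≈ g → F₁ f 𝒟.≈ F₁ g
    F-id  : ∀ {A} → F₁ (𝒞.id {A}) 𝒟.≈ 𝒟.id
    F-⨾   : ∀ {A B C} (f : A 𝒞.⇒ B) (g : B 𝒞.⇒ C) →
            F₁ (f 𝒞.⨾ g) 𝒟.≈ F₁ f 𝒟.⨾ F₁ g

record NatIso {o ℓ e o' ℓ' e'} (𝒞 : Category o ℓ e) (𝒟 : Category o' ℓ' e')
       (F₀ G₀ : Category.Obj 𝒞 → Category.Obj 𝒟)
       (F₁ : ∀ {A B} → Category._⇒_ 𝒞 A B → Category._⇒_ 𝒟 (F₀ A) (F₀ B))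
       (G₁ : ∀ {A B} → Category._⇒_ 𝒞 A B → Category._⇒_ 𝒟 (G₀ A) (G₀ B))
       : Set (o ⊔ ℓ ⊔ e ⊔ o' ⊔ ℓ' ⊔ e') where
  private
    module 𝒞 = Category 𝒞
    module 𝒟 = Category 𝒟
  field
    η       : ∀ X → F₀ X 𝒟.⇒ G₀ X
    η⁻¹     : ∀ X → G₀ X 𝒟.⇒ F₀ X
    iso₁    : ∀ X → η X 𝒟.⨾ η⁻¹ X 𝒟.≈ 𝒟.id
    iso₂    : ∀ X → η⁻¹ X 𝒟.⨾ η X 𝒟.≈ 𝒟.id
    natural : ∀ {X Y} (f : X 𝒞.⇒ Y) → F₁ f 𝒟.⨾ η Y 𝒟.≈ η X 𝒟.⨾ G₁ f

record IsCatEquivalence {o ℓ e o' ℓ' e'} {𝒞 : Category o ℓ e} {𝒟 : Category o' ℓ' e'}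
       (F : Functor 𝒞 𝒟) : Set (o ⊔ ℓ ⊔ e ⊔ o' ⊔ ℓ' ⊔ e') where
  private
    module F = Functor F
  field
    inverse : Functor 𝒟 𝒞
  private
    module G = Functor inverse
  field
    unit   : NatIso 𝒞 𝒞 (λ X → X) (λ X → G.F₀ (F.F₀ X)) (λ f → f) (λ f → G.F₁ (F.F₁ f))
    counit : NatIso 𝒟 𝒟 (λ X → F.F₀ (G.F₀ X)) (λ X → X) (λ f → F.F₁ (G.F₁ f)) (λ f → f)

record MonoidalCategory (o ℓ e : Level) : Set (lsuc (o ⊔ ℓ ⊔ e)) where
  field
    category : Category o ℓ e
  open Category category public
  infixr 10 _⊗₀_ _⊗₁_
  field
    I      : Obj
    _⊗₀_   : Obj → Obj → Obj
    _⊗₁_   : ∀ {A B C D} → A ⇒ B → C ⇒ D → (A ⊗₀ C) ⇒ (B ⊗₀ D)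
    ⊗-resp : ∀ {A B C D} {f f' : A ⇒ B} {g g' : C ⇒ D} →
             f ≈ f' → g ≈ g' → f ⊗₁ g ≈ f' ⊗₁ g'
    ⊗-id   : ∀ {A B} → id {A} ⊗₁ id {B} ≈ id
    ⊗-⨾    : ∀ {A B C D E F} {f : A ⇒ B} {g : B ⇒ C} {h : D ⇒ E} {k : E ⇒ F} →
             (f ⨾ g) ⊗₁ (h ⨾ k) ≈ (f ⊗₁ h) ⨾ (g ⊗₁ k)
    α⇒     : ∀ {A B C} → (A ⊗₀ B) ⊗₀ C ⇒ A ⊗₀ (B ⊗₀ C)
    α⇐     : ∀ {A B C} → A ⊗₀ (B ⊗₀ C) ⇒ (A ⊗₀ B) ⊗₀ C
    α-iso₁ : ∀ {A B C} → α⇒ {A} {B} {C} ⨾ α⇐ ≈ id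
    α-iso₂ : ∀ {A B C} → α⇐ {A} {B} {C} ⨾ α⇒ ≈ id
    α-nat  : ∀ {A B C A' B' C'} {f : A ⇒ A'} {g : B ⇒ B'} {h : C ⇒ C'} →
             ((f ⊗₁ g) ⊗₁ h) ⨾ α⇒ ≈ α⇒ ⨾ (f ⊗₁ (g ⊗₁ h))
    unitˡ⇒ : ∀ {A} → I ⊗₀ A ⇒ A
    unitˡ⇐ : ∀ {A} → A ⇒ I ⊗₀ A
    unitˡ-iso₁ : ∀ {A} → unitˡ⇒ {A} ⨾ unitˡ⇐ ≈ id
    unitˡ-iso₂ : ∀ {A} → unitˡ⇐ {A} ⨾ unitˡ⇒ ≈ id
    unitˡ-nat  : ∀ {A B} {f : A ⇒ B} → (id ⊗₁ f) ⨾ unitˡ⇒ ≈ unitˡ⇒ ⨾ f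
    unitʳ⇒ : ∀ {A} → A ⊗₀ I ⇒ A
    unitʳ⇐ : ∀ {A} → A ⇒ A ⊗₀ I
    unitʳ-iso₁ : ∀ {A} → unitʳ⇒ {A} ⨾ unitʳ⇐ ≈ id
    unitʳ-iso₂ : ∀ {A} → unitʳ⇐ {A} ⨾ unitʳ⇒ ≈ id
    unitʳ-nat  : ∀ {A B} {f : A ⇒ B} → (f ⊗₁ id) ⨾ unitʳ⇒ ≈ unitʳ⇒ ⨾ f
    triangle   : ∀ {A B} → α⇒ {A} {I} {B} ⨾ (id ⊗₁ unitˡ⇒) ≈ unitʳ⇒ ⊗₁ id
    pentagon   : ∀ {A B C D} →
                 (α⇒ {A} {B} {C} ⊗₁ id {D}) ⨾ α⇒ ⨾ (id ⊗₁ α⇒) ≈ α⇒ ⨾ α⇒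

-- Part 2.  Algebraic languages: signatures, raw terms, the term calculus

-- A finitary many-sorted signature: atomic types (sorts) and functional
-- constants f : B₁,…,Bₙ → Bₙ₊₁  (dom f = B₁…Bₙ, cod f = Bₙ₊₁).
record Signature : Set₁ where
  field
    Sort : Set
    Fun  : Set
    dom  : Fun → List Sort
    cod  : Fun → Sort

record Language : Set₁ where
  field
    sig         : Signature
    weakening   : Bool
    exchange    : Bool
    contraction : Bool
  open Signature sig public

-- Permutations of n elements, in canonical (Lehmer code) form, so that
-- distinct codes are distinct permutations.
Perm : ℕ → Set
Perm zero    = ⊤
Perm (suc n) = Fin (suc n) × Perm n

insertAt : ∀ {a} {X : Set a} → ℕ → X → List X → List X
insertAt zero    x ys       = x ∷ ys
insertAt (suc k) x []       = x ∷ []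
insertAt (suc k) x (y ∷ ys) = y ∷ insertAt k x ys

act : ∀ {a} {X : Set a} {n} → Perm n → List X → List X
act {n = zero}  _       xs       = xs
act {n = suc n} (i , p) []       = []
act {n = suc n} (i , p) (x ∷ xs) = insertAt (toℕ i) x (act p xs)

module Syntax (L : Language) where
  open Language L

  Var : Set
  Var = ℕ

  -- a type is a finite sequence of atomic types; ∅ is []
  Type : Set
  Type = List Sort

  -- Raw terms.  The tensor is associative with unit ∅, so a raw term is a
  -- finite sequence (List) of "atoms", an atom being a variables or f(t₁,…,tₙ).
  data Atom : Set where
    var : Var → Atom
    app : Fun → List (List Atom) → Atom

  Tm : Set
  Tm = List Atom

  lookupVar : Var → List Var → List Atom → Atom
  lookupVar v []       _        = var v
  lookupVar v (y ∷ ys) []       = var v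
  lookupVar v (y ∷ ys) (s ∷ ss) with v ≟ y
  ... | yes _ = s
  ... | no  _ = lookupVar v ys ss

  mutual
    substA : List Var → List Atom → Atom → Atom
    substA ys ss (var v)    = lookupVar v ys ss
    substA ys ss (app f ts) = app f (substTs ys ss ts)

    substT : List Var → List Atom → Tm → Tm
    substT ys ss []       = []
    substT ys ss (a ∷ as) = substA ys ss a ∷ substT ys ss as

    substTs : List Var → List Atom → List Tm → List Tm
    substTs ys ss []       = []
    substTs ys ss (t ∷ ts) = substT ys ss t ∷ substTs ys ss ts

  vars : List Var → Tm
  vars = map var

  -- Derivable sequents  x : A ⊢ t : B   (Der x A t B), with the rules of L.
  -- Structural rules are available only if the language has them.
  mutual
    data Der : List Var → Type → Tm → Type → Set where
      variables     : (v : Var) (a : Sort) → Der [ v ] [ a ] [ var v ] [ a ]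
      function     : (f : Fun) {xs : List Var} {As : Type} {ts : List Tm} →
                     Args (dom f) xs As ts → Unique xs →
                     Der xs As [ app f ts ] [ cod f ]
      substitution : ∀ {x A s B y t C} →
                     Der x A s B → Der y B t C → Der x A (substT y s t) C
      unit         : Der [] [] [] []
      tensor       : ∀ {x A s B y C t D} →
                     Der x A s B → Der y C t D → Unique (x ++ y) →
                     Der (x ++ y) (A ++ C) (s ++ t) (B ++ D)
      weaken       : T weakening → ∀ {t B} (x₁ x₂ x₃ : List Var) (A₁ A₂ A₃ : Type) →
                     length x₁ ≡ length A₁ → length x₂ ≡ length A₂ →
                     Unique (x₁ ++ x₂ ++ x₃) →
                     Der (x₁ ++ x₃) (A₁ ++ A₃) t B →
                     Der (x₁ ++ x₂ ++ x₃) (A₁ ++ A₂ ++ A₃) t B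
      exchange'    : T exchange → ∀ {x A t B} (σ : Perm (length A)) →
                     Der x A t B → Der (act σ x) (act σ A) t B
      contract     : T contraction → ∀ {t B} (x₁ x x' x₂ : List Var) (A₁ A A₂ : Type) →
                     length x₁ ≡ length A₁ → length x ≡ length A → length x' ≡ length A →
                     Der (x₁ ++ x ++ x' ++ x₂) (A₁ ++ A ++ A ++ A₂) t B →
                     Der (x₁ ++ x ++ x₂) (A₁ ++ A ++ A₂) (substT x' (vars x) t) B

    data Args : Type → List Var → Type → List Tm → Set where
      []  : Args [] [] [] []
      _∷_ : ∀ {x A t b bs xs As ts} →
            Der x A t [ b ] → Args bs xs As ts →
            Args (b ∷ bs) (x ++ xs) (A ++ As) (t ∷ ts)

  record Term (A B : Type) : Set where
    constructor term
    field
      tvars : List Var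
      body  : Tm
      der   : Der tvars A body B
  open Term public

  _≈T_ : ∀ {A B} → Term A B → Term A B → Set
  _≈T_ {A} s t = Σ (List Var) λ z → Unique z × length z ≡ length A ×
                 substT (tvars s) (vars z) (body s) ≡ substT (tvars t) (vars z) (body t)

  _⨾T_ : ∀ {A B C} → Term A B → Term B C → Term A C
  s ⨾T t = term (tvars s) (substT (tvars t) (body s) (body t)) (substitution (der s) (der t))

  tensorT : ∀ {A B C D} (s : Term A B) (t : Term C D) → Unique (tvars s ++ tvars t) →
            Term (A ++ C) (B ++ D)
  tensorT s t u = term (tvars s ++ tvars t) (body s ++ body t) (tensor (der s) (der t) u)

  Der-cast : ∀ {x x' A A' t t' B B'} → x ≡ x' → A ≡ A' → t ≡ t' → B ≡ B' →
             Der x A t B → Der x' A' t' B'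
  Der-cast refl refl refl refl D = D

  gvars : ℕ → Type → List Var
  gvars k []      = []
  gvars k (a ∷ A) = k ∷ gvars (suc k) A

  gvars-len : ∀ k A → length (gvars k A) ≡ length A
  gvars-len k []      = refl
  gvars-len k (a ∷ A) = cong suc (gvars-len (suc k) A)

  gvars-lower : ∀ j k A → j ≤ k → All (j ≤_) (gvars k A)
  gvars-lower j k []      _   = []
  gvars-lower j k (a ∷ A) j≤k = j≤k ∷ gvars-lower j (suc k) A (≤-trans j≤k (n≤1+n k))

  gvars-upper : ∀ k A → All (_< k + length A) (gvars k A)
  gvars-upper k []      = []
  gvars-upper k (a ∷ A) =
    subst (k <_) (sym (+-suc k (length A))) (Data.Nat.s≤s (Data.Nat.Properties.m≤m+n k (length A)))
    ∷ All.map (λ {v} p → subst (v <_) (sym (+-suc k (length A))) p) (gvars-upper (suc k) A)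

  gvars-unique : ∀ k A → Unique (gvars k A)
  gvars-unique k []      = []
  gvars-unique k (a ∷ A) =
    All.map (λ p → <⇒≢ p) (gvars-lower (suc k) (suc k) A ≤-refl) ∷ gvars-unique (suc k) A

  len-++ : ∀ {a b} {X : Set a} {Y : Set b} {x x' : List X} {A A' : List Y} →
           length x ≡ length A → length x' ≡ length A' → length (x ++ x') ≡ length (A ++ A')
  len-++ {x = []}    {A = []}    e e' = e'
  len-++ {x = _ ∷ x} {A = _ ∷ A} e e' = cong suc (len-++ {x = x} {A = A} (suc-injective e) e')

  unique-++ : ∀ {xs ys : List Var} → Unique xs → Unique ys →
              All (λ v → All (v ≢_) ys) xs → Unique (xs ++ ys)
  unique-++ []         uy []       = uy
  unique-++ (px ∷ ux)  uy (h ∷ hs) = AllP.++⁺ px h ∷ unique-++ ux uy hs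

  idDer : ∀ x A → length x ≡ length A → Unique x → Der x A (vars x) A
  idDer []      []      _ _        = unit
  idDer (v ∷ x) (a ∷ A) e (h ∷ u) =
    tensor (variables v a) (idDer x A (suc-injective e) u) (h ∷ u)
  idDer []      (_ ∷ _) () _
  idDer (_ ∷ _) []      () _

  idDer-g : ∀ A → Der (gvars 0 A) A (vars (gvars 0 A)) A
  idDer-g A = idDer (gvars 0 A) A (gvars-len 0 A) (gvars-unique 0 A)

  substT-vars : ∀ ys ss z → substT ys ss (vars z) ≡ map (λ v → lookupVar v ys ss) z
  substT-vars ys ss []      = refl
  substT-vars ys ss (v ∷ z) = cong (lookupVar v ys ss ∷_) (substT-vars ys ss z)

  lookup-miss : ∀ v ys ss → All (v ≢_) ys → lookupVar v ys ss ≡ var v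
  lookup-miss v []       ss       []       = refl
  lookup-miss v (y ∷ ys) []       _        = refl
  lookup-miss v (y ∷ ys) (s ∷ ss) (n ∷ ns) with v ≟ y
  ... | yes p = ⊥-elim (n p)
  ... | no  _ = lookup-miss v ys ss ns

  map-miss : ∀ ys ss z → All (λ v → All (v ≢_) ys) z →
             map (λ v → lookupVar v ys ss) z ≡ vars z
  map-miss ys ss []      []       = refl
  map-miss ys ss (v ∷ z) (h ∷ hs) = cong₂ _∷_ (lookup-miss v ys ss h) (map-miss ys ss z hs)

  skip-head : ∀ y s ys ss zs → All (y ≢_) zs →
              map (λ v → lookupVar v (y ∷ ys) (s ∷ ss)) zs ≡ map (λ v → lookupVar v ys ss) zs
  skip-head y s ys ss []       []       = refl
  skip-head y s ys ss (z ∷ zs) (n ∷ ns) with z ≟ y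
  ... | yes p = ⊥-elim (n (sym p))
  ... | no  _ = cong (lookupVar z ys ss ∷_) (skip-head y s ys ss zs ns)

  map-hit : ∀ ys ss → Unique ys → length ys ≡ length ss →
            map (λ v → lookupVar v ys ss) ys ≡ ss
  map-hit []       []       _        _ = refl
  map-hit (y ∷ ys) (s ∷ ss) (h ∷ u) e with y ≟ y
  ... | no ¬p = ⊥-elim (¬p refl)
  ... | yes _ = cong (s ∷_) (trans (skip-head y s ys ss ys h) (map-hit ys ss u (suc-injective e)))
  map-hit []       (_ ∷ _)  _ ()
  map-hit (_ ∷ _)  []       _ ()

  len-vars : ∀ z → length (vars z) ≡ length z
  len-vars []      = refl
  len-vars (_ ∷ z) = cong suc (len-vars z)

  map-++ : ∀ {a b} {X : Set a} {Y : Set b} (f : X → Y) (xs ys : List X) →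
           map f (xs ++ ys) ≡ map f xs ++ map f ys
  map-++ f []       ys = refl
  map-++ f (x ∷ xs) ys = cong (f x ∷_) (map-++ f xs ys)

  gvars-disjoint : ∀ A → All (λ v → All (v ≢_) (gvars (length A) A)) (gvars 0 A)
  gvars-disjoint A =
    All.map (λ {v} v<n → All.map (λ {w} n≤w → <⇒≢ (<-≤-trans v<n n≤w))
                                 (gvars-lower (length A) (length A) A ≤-refl))
            (gvars-upper 0 A)

  -- The generic L-structure G in the term category (its arrows)

  argTms : ℕ → Type → List Tm
  argTms k []      = []
  argTms k (b ∷ B) = [ var k ] ∷ argTms (suc k) B

  argsVar : ∀ k B → Args B (gvars k B) B (argTms k B)
  argsVar k []      = []
  argsVar k (b ∷ B) = variables k b ∷ argsVar (suc k) B

  genFun : (f : Fun) → Term (dom f) [ cod f ]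
  genFun f = term (gvars 0 (dom f)) [ app f (argTms 0 (dom f)) ]
                  (function f (argsVar 0 (dom f)) (gvars-unique 0 (dom f)))

  genπ : T weakening → (A : Type) → Term A []
  genπ w A = term (gvars 0 A) []
    (Der-cast (++-identityʳ (gvars 0 A)) (++-identityʳ A) refl refl
      (weaken w [] (gvars 0 A) [] [] A [] refl (gvars-len 0 A)
        (subst Unique (sym (++-identityʳ (gvars 0 A))) (gvars-unique 0 A)) unit))

  genσ : T exchange → (A : Type) (σ : Perm (length A)) → Term (act σ A) A
  genσ e A σ = term (act σ (gvars 0 A)) (vars (gvars 0 A)) (exchange' e σ (idDer-g A))

  -- Δ_A = (x : A ⊢ x x : A A), obtained by contraction from x x' : A A ⊢ x x'
  private
    Δ-unique : ∀ A → Unique (gvars 0 A ++ gvars (length A) A ++ [])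
    Δ-unique A = unique-++ (gvars-unique 0 A)
      (subst Unique (sym (++-identityʳ (gvars (length A) A))) (gvars-unique (length A) A))
      (subst (λ ys → All (λ v → All (v ≢_) ys) (gvars 0 A))
             (sym (++-identityʳ (gvars (length A) A))) (gvars-disjoint A))

    Δ-len : ∀ A → length (gvars 0 A ++ gvars (length A) A ++ []) ≡ length (A ++ A ++ [])
    Δ-len A = len-++ {x = gvars 0 A} {A = A} (gvars-len 0 A)
                (len-++ {x = gvars (length A) A} {A = A} (gvars-len (length A) A) refl)

    Δ-term : ∀ A → substT (gvars (length A) A) (vars (gvars 0 A))
                     (vars (gvars 0 A ++ gvars (length A) A ++ []))
                   ≡ vars (gvars 0 A) ++ vars (gvars 0 A)
    Δ-term A =
      let x  = gvars 0 A
          x' = gvars (length A) A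
          f  = λ v → lookupVar v x' (vars x)
      in trans (substT-vars x' (vars x) (x ++ x' ++ []))
        (trans (map-++ f x (x' ++ []))
        (cong₂ _++_ (map-miss x' (vars x) x (gvars-disjoint A))
          (trans (cong (map f) (++-identityʳ x'))
            (map-hit x' (vars x) (gvars-unique (length A) A)
              (trans (gvars-len (length A) A) (sym (trans (len-vars x) (gvars-len 0 A))))))))

  genΔ : T contraction → (A : Type) → Term A (A ++ A)
  genΔ c A = term (gvars 0 A) (vars (gvars 0 A) ++ vars (gvars 0 A))
    (Der-cast (++-identityʳ (gvars 0 A)) (++-identityʳ A) (Δ-term A)
              (cong (A ++_) (++-identityʳ A))
      (contract c [] (gvars 0 A) (gvars (length A) A) [] [] A [] refl
        (gvars-len 0 A) (gvars-len (length A) A)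
        (idDer (gvars 0 A ++ gvars (length A) A ++ []) (A ++ A ++ []) (Δ-len A) (Δ-unique A))))

-- Part 3.  Structures in a monoidal category, the categories
--          Str(L,C) and hom(L,C), and evaluation at G

module Semantics {o ℓ e : Level} (L : Language) (C : MonoidalCategory o ℓ e) where
  open Language L
  open Syntax L
  open MonoidalCategory C

  private
    infixr 5 _○_
    _○_ : ∀ {A B} {f g h : A ⇒ B} → f ≈ g → g ≈ h → f ≈ h
    _○_ = Eq.trans
    ≈sym : ∀ {A B} {f g : A ⇒ B} → f ≈ g → g ≈ f
    ≈sym = Eq.sym
    ≈refl : ∀ {A B} {f : A ⇒ B} → f ≈ f
    ≈refl = Eq.refl

  tyObj : (Sort → Obj) → Type → Obj
  tyObj obj []      = I
  tyObj obj (a ∷ A) = obj a ⊗₀ tyObj obj A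

  record Prestructure : Set (o ⊔ ℓ) where
    field
      obj : Sort → Obj
      fun : (f : Fun) → tyObj obj (dom f) ⇒ obj (cod f)
      π   : T weakening → (A : Type) → tyObj obj A ⇒ I
      σ   : T exchange → (A : Type) (p : Perm (length A)) → tyObj obj (act p A) ⇒ tyObj obj A
      Δ   : T contraction → (A : Type) → tyObj obj A ⇒ tyObj obj (A ++ A)

  module Interp (M : Prestructure) where
    open Prestructure M

    ⟦_⟧ : Type → Obj
    ⟦ A ⟧ = tyObj obj A

    split : ∀ A B → ⟦ A ++ B ⟧ ⇒ ⟦ A ⟧ ⊗₀ ⟦ B ⟧
    split []      B = unitˡ⇐
    split (a ∷ A) B = (id ⊗₁ split A B) ⨾ α⇐

    merge : ∀ A B → ⟦ A ⟧ ⊗₀ ⟦ B ⟧ ⇒ ⟦ A ++ B ⟧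
    merge []      B = unitˡ⇒
    merge (a ∷ A) B = α⇒ ⨾ (id ⊗₁ merge A B)

    weakArr : T weakening → ∀ A₁ A₂ A₃ → ⟦ A₁ ++ A₂ ++ A₃ ⟧ ⇒ ⟦ A₁ ++ A₃ ⟧
    weakArr w A₁ A₂ A₃ =
      split A₁ (A₂ ++ A₃) ⨾ (id ⊗₁ (split A₂ A₃ ⨾ (π w A₂ ⊗₁ id) ⨾ unitˡ⇒)) ⨾ merge A₁ A₃

    contrArr : T contraction → ∀ A₁ A A₂ → ⟦ A₁ ++ A ++ A₂ ⟧ ⇒ ⟦ A₁ ++ A ++ A ++ A₂ ⟧
    contrArr c A₁ A A₂ =
      split A₁ (A ++ A₂) ⨾
      (id ⊗₁ (split A A₂ ⨾ ((Δ c A ⨾ split A A) ⊗₁ id) ⨾ α⇒ ⨾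
              (id ⊗₁ merge A A₂) ⨾ merge A (A ++ A₂))) ⨾
      merge A₁ (A ++ A ++ A₂)

    mutual
      interp : ∀ {x A t B} → Der x A t B → ⟦ A ⟧ ⇒ ⟦ B ⟧
      interp (variables v a)            = id
      interp (function f args _)       = interpArgs args ⨾ fun f ⨾ unitʳ⇐
      interp (substitution D E)        = interp D ⨾ interp E
      interp unit                      = id
      interp (tensor {A = A} {B = B} {C = C'} {D = D'} d₁ d₂ _) =
        split A C' ⨾ (interp d₁ ⊗₁ interp d₂) ⨾ merge B D'
      interp (weaken w _ _ _ A₁ A₂ A₃ _ _ _ D) = weakArr w A₁ A₂ A₃ ⨾ interp D
      interp (exchange' x {A = A} p D) = σ x A p ⨾ interp D
      interp (contract c _ _ _ _ A₁ A A₂ _ _ _ D) = contrArr c A₁ A A₂ ⨾ interp D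

      interpArgs : ∀ {bs xs As ts} → Args bs xs As ts → ⟦ As ⟧ ⇒ ⟦ bs ⟧
      interpArgs []                                  = id
      interpArgs (_∷_ {A = A} {b = b} {bs = bs} {As = As} D rest) =
        split A As ⨾ (interp D ⊗₁ interpArgs rest) ⨾ merge [ b ] bs

  IsStructure : Prestructure → Set e
  IsStructure M = ∀ {x A t B} (D E : Der x A t B) → Interp.interp M D ≈ Interp.interp M E

  record Structure : Set (o ⊔ ℓ ⊔ e) where
    field
      pre         : Prestructure
      isStructure : IsStructure pre

  extend : (M N : Prestructure) → ((a : Sort) → Prestructure.obj M a ⇒ Prestructure.obj N a) →
           (A : Type) → Interp.⟦_⟧ M A ⇒ Interp.⟦_⟧ N A
  extend M N h []      = id
  extend M N h (a ∷ A) = h a ⊗₁ extend M N h A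

  IsMorphism : (M N : Prestructure) → ((a : Sort) → Prestructure.obj M a ⇒ Prestructure.obj N a) →
               Set e
  IsMorphism M N h = ∀ {x A t B} (D : Der x A t B) →
    extend M N h A ⨾ Interp.interp N D ≈ Interp.interp M D ⨾ extend M N h B

  record Morphism (M N : Prestructure) : Set (ℓ ⊔ e) where
    field
      comp       : (a : Sort) → Prestructure.obj M a ⇒ Prestructure.obj N a
      isMorphism : IsMorphism M N comp
  open Morphism

  private
    extend-id : ∀ M A → extend M M (λ a → id) A ≈ id
    extend-id M []      = ≈refl
    extend-id M (a ∷ A) = ⊗-resp ≈refl (extend-id M A) ○ ⊗-id

    extend-⨾ : ∀ M N P (h : ∀ a → _) (h' : ∀ a → _) A →
               extend M P (λ a → h a ⨾ h' a) A ≈ extend M N h A ⨾ extend N P h' A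
    extend-⨾ M N P h h' []      = ≈sym idˡ
    extend-⨾ M N P h h' (a ∷ A) = ⊗-resp ≈refl (extend-⨾ M N P h h' A) ○ ⊗-⨾

    idMor : ∀ M → Morphism M M
    idMor M = record
      { comp = λ a → id
      ; isMorphism = λ {_} {A} {_} {B} D →
          ⨾-resp (extend-id M A) ≈refl ○ idˡ ○ ≈sym idʳ ○ ⨾-resp ≈refl (≈sym (extend-id M B)) }

    compMor : ∀ {M N P} → Morphism M N → Morphism N P → Morphism M P
    compMor {M} {N} {P} h h' = record
      { comp = λ a → comp h a ⨾ comp h' a
      ; isMorphism = λ {_} {A} {_} {B} D →
          ⨾-resp (extend-⨾ M N P (comp h) (comp h') A) ≈refl ○ assoc ○
          ⨾-resp ≈refl (isMorphism h' D) ○ ≈sym assoc ○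
          ⨾-resp (isMorphism h D) ≈refl ○ assoc ○
          ⨾-resp ≈refl (≈sym (extend-⨾ M N P (comp h) (comp h') B)) }

  StrCat : Category (o ⊔ ℓ ⊔ e) (ℓ ⊔ e) e
  StrCat = record
    { Obj    = Structure
    ; _⇒_    = λ M N → Morphism (Structure.pre M) (Structure.pre N)
    ; _≈_    = λ h h' → ∀ a → comp h a ≈ comp h' a
    ; id     = idMor _
    ; _⨾_    = compMor
    ; equiv  = record { refl = λ a → ≈refl ; sym = λ p a → ≈sym (p a)
                      ; trans = λ p q a → p a ○ q a }
    ; ⨾-resp = λ p q a → ⨾-resp (p a) (q a)
    ; assoc  = λ a → assoc
    ; idˡ    = λ a → idˡ
    ; idʳ    = λ a → idʳ
    }

  coe : (F₀ : Type → Obj) → ∀ {A B} → A ≡ B → F₀ A ⇒ F₀ B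
  coe F₀ refl = id

  -- Strong monoidal functors from the (strict monoidal) term category L to C.
  -- Arrows of L are terms modulo alphabetical variance (_≈T_); composition
  -- is substitution, identities are  x : A ⊢ x : A, the tensor is
  -- concatenation of types and tensor of terms (taken on representatives
  -- with disjoint variables), and the coherence isomorphisms of L are
  -- identities.
  record StrongMonoidal : Set (o ⊔ ℓ ⊔ e) where
    field
      F₀     : Type → Obj
      F₁     : ∀ {A B} → Term A B → F₀ A ⇒ F₀ B
      F-resp : ∀ {A B} {s t : Term A B} → s ≈T t → F₁ s ≈ F₁ t
      F-id   : ∀ {A} (x : List Var) (D : Der x A (vars x) A) → F₁ (term x (vars x) D) ≈ id
      F-⨾    : ∀ {A B C} (s : Term A B) (t : Term B C) → F₁ (s ⨾T t) ≈ F₁ s ⨾ F₁ t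
      φ₀     : I ⇒ F₀ []
      φ₀⁻¹   : F₀ [] ⇒ I
      φ₀-iso₁ : φ₀ ⨾ φ₀⁻¹ ≈ id
      φ₀-iso₂ : φ₀⁻¹ ⨾ φ₀ ≈ id
      φ      : ∀ A B → F₀ A ⊗₀ F₀ B ⇒ F₀ (A ++ B)
      φ⁻¹    : ∀ A B → F₀ (A ++ B) ⇒ F₀ A ⊗₀ F₀ B
      φ-iso₁ : ∀ A B → φ A B ⨾ φ⁻¹ A B ≈ id
      φ-iso₂ : ∀ A B → φ⁻¹ A B ⨾ φ A B ≈ id
      φ-natural : ∀ {A B C D} (s : Term A B) (t : Term C D) (u : Unique (tvars s ++ tvars t)) →
                  (F₁ s ⊗₁ F₁ t) ⨾ φ B D ≈ φ A C ⨾ F₁ (tensorT s t u)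
      φ-assoc : ∀ A B C → (φ A B ⊗₁ id) ⨾ φ (A ++ B) C ⨾ coe F₀ (++-assoc A B C)
                          ≈ α⇒ ⨾ (id ⊗₁ φ B C) ⨾ φ A (B ++ C)
      φ-unitˡ : ∀ A → (φ₀ ⊗₁ id) ⨾ φ [] A ≈ unitˡ⇒
      φ-unitʳ : ∀ A → (id ⊗₁ φ₀) ⨾ φ A [] ⨾ coe F₀ (++-identityʳ A) ≈ unitʳ⇒

  record MonoidalNT (F F' : StrongMonoidal) : Set (ℓ ⊔ e) where
    private
      module F  = StrongMonoidal F
      module F' = StrongMonoidal F'
    field
      η        : ∀ A → F.F₀ A ⇒ F'.F₀ A
      natural  : ∀ {A B} (s : Term A B) → η A ⨾ F'.F₁ s ≈ F.F₁ s ⨾ η B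
      monoidal : ∀ A B → F.φ A B ⨾ η (A ++ B) ≈ (η A ⊗₁ η B) ⨾ F'.φ A B
      monoidal₀ : F.φ₀ ⨾ η [] ≈ F'.φ₀
  open MonoidalNT

  private
    idNT : ∀ F → MonoidalNT F F
    idNT F = record
      { η = λ A → id
      ; natural = λ s → idˡ ○ ≈sym idʳ
      ; monoidal = λ A B → idʳ ○ ≈sym idˡ ○ ⨾-resp (≈sym ⊗-id) ≈refl
      ; monoidal₀ = idʳ }

    compNT : ∀ {F F' F''} → MonoidalNT F F' → MonoidalNT F' F'' → MonoidalNT F F''
    compNT {F} {F'} {F''} k k' = record
      { η = λ A → η k A ⨾ η k' A
      ; natural = λ s → assoc ○ ⨾-resp ≈refl (natural k' s) ○ ≈sym assoc ○
                        ⨾-resp (natural k s) ≈refl ○ assoc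
      ; monoidal = λ A B → ≈sym assoc ○ ⨾-resp (monoidal k A B) ≈refl ○ assoc ○
                           ⨾-resp ≈refl (monoidal k' A B) ○ ≈sym assoc ○
                           ⨾-resp (≈sym ⊗-⨾) ≈refl
      ; monoidal₀ = ≈sym assoc ○ ⨾-resp (monoidal₀ k) ≈refl ○ monoidal₀ k' }

  HomCat : Category (o ⊔ ℓ ⊔ e) (ℓ ⊔ e) e
  HomCat = record
    { Obj    = StrongMonoidal
    ; _⇒_    = MonoidalNT
    ; _≈_    = λ k k' → ∀ A → η k A ≈ η k' A
    ; id     = idNT _
    ; _⨾_    = compNT
    ; equiv  = record { refl = λ A → ≈refl ; sym = λ p A → ≈sym (p A)
                      ; trans = λ p q A → p A ○ q A }
    ; ⨾-resp = λ p q A → ⨾-resp (p A) (q A)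
    ; assoc  = λ A → assoc
    ; idˡ    = λ A → idˡ
    ; idʳ    = λ A → idʳ
    }

  module Eval (F : StrongMonoidal) where
    open StrongMonoidal F

    objFG : Sort → Obj
    objFG a = F₀ [ a ]

    ψ : ∀ A → tyObj objFG A ⇒ F₀ A
    ψ []      = φ₀
    ψ (a ∷ A) = (id ⊗₁ ψ A) ⨾ φ [ a ] A

    ψ⁻¹ : ∀ A → F₀ A ⇒ tyObj objFG A
    ψ⁻¹ []      = φ₀⁻¹
    ψ⁻¹ (a ∷ A) = φ⁻¹ [ a ] A ⨾ (id ⊗₁ ψ⁻¹ A)

    FG : Prestructure
    FG = record
      { obj = objFG
      ; fun = λ f → ψ (dom f) ⨾ F₁ (genFun f)
      ; π   = λ w A → ψ A ⨾ F₁ (genπ w A) ⨾ φ₀⁻¹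
      ; σ   = λ x A p → ψ (act p A) ⨾ F₁ (genσ x A p) ⨾ ψ⁻¹ A
      ; Δ   = λ c A → ψ A ⨾ F₁ (genΔ c A) ⨾ ψ⁻¹ (A ++ A)
      }

  evalObj : StrongMonoidal → Prestructure
  evalObj F = Eval.FG F

  evalMor : ∀ {F F'} → MonoidalNT F F' → (a : Sort) →
            Prestructure.obj (evalObj F) a ⇒ Prestructure.obj (evalObj F') a
  evalMor k a = η k [ a ]

  -- The evaluation functor hom(L,C) → Str(L,C), given that it is
  -- well defined on objects (FG is an L-structure) and on arrows.
  Ev : (str : ∀ F → IsStructure (evalObj F)) →
       (mor : ∀ {F F'} (k : MonoidalNT F F') → IsMorphism (evalObj F) (evalObj F') (evalMor k)) →
       Functor HomCat StrCat
  Ev str mor = record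
    { F₀   = λ F → record { pre = evalObj F ; isStructure = str F }
    ; F₁   = λ k → record { comp = evalMor k ; isMorphism = mor k }
    ; resp = λ p a → p [ a ]
    ; F-id = λ a → ≈refl
    ; F-⨾  = λ k k' a → ≈refl
    }

module Submission where

-- For a strong monoidal F : 𝐋 → 𝐂 the coherence isomorphisms of F assemble into isomorphisms
-- ψ_A : |A|_{FG} → F A, and by induction on derivations ψ carries the interpretation in FG of any
-- derivation of x : A ⊢ t : B to F t: every rule is a composite, a tensor, or a substitution into
-- a tensor of identities with the generic arrows |f|, π, σ, Δ, all of which F preserves. As F t
-- depends only on the term, FG is an L-structure, and naturality of a monoidal transformation k
-- makes (k_a) a morphism of structures. Conversely an L-structure M is itself a strong monoidal
-- functor t ↦ |t|_M, well defined on alphabetical variants because interpretation is independent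
-- of derivations. The ψ form the unit F ≅ |−|_{FG}, and the right unitors |a| ⊗ 1 ≅ |a| the counit.

open import Defs
open import Level using (Level)
open import Data.Bool using (T)
open import Data.Nat using (zero; suc; _≟_)
open import Data.Nat.Properties using (suc-injective)
open import Data.Fin using (toℕ)
open import Data.List using (List; []; _∷_; _++_; length; map; [_]; concat)
open import Data.List.Properties using (++-assoc; ++-identityʳ; map-cong)
open import Data.List.Membership.Propositional using (_∈_)
open import Data.List.Membership.DecPropositional _≟_ using (_∈?_)
open import Data.List.Relation.Unary.All using (All; []; _∷_)
import Data.List.Relation.Unary.All.Properties as All
open import Data.List.Relation.Unary.Any using (here; there; tail)
open import Data.List.Relation.Unary.AllPairs using ([]; _∷_)
open import Data.List.Relation.Unary.Unique.Propositional using (Unique)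
open import Data.Product using (Σ; _,_; _×_; proj₁; proj₂)
open import Data.Empty using (⊥-elim)
open import Relation.Nullary using (yes; no)
open import Relation.Binary.Bundles using (Setoid)
import Relation.Binary.Reasoning.Setoid as SetoidReasoning
open import Relation.Binary.PropositionalEquality
  using (_≡_; _≢_; refl; sym; trans; cong; cong₂; subst; module ≡-Reasoning)

private
  variable
    a : Level
    X Y : Set a

length-++-cancelˡ : (xs : List X) (ys : List Y) {xs' : List X} {ys' : List Y} →
                    length (xs ++ xs') ≡ length (ys ++ ys') → length xs ≡ length ys →
                    length xs' ≡ length ys'
length-++-cancelˡ []       []       e _ = e
length-++-cancelˡ (_ ∷ xs) (_ ∷ ys) e l = length-++-cancelˡ xs ys (suc-injective e) (suc-injective l)

Unique-++⁻ˡ : (xs : List X) {ys : List X} → Unique (xs ++ ys) → Unique xs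
Unique-++⁻ˡ []       _       = []
Unique-++⁻ˡ (_ ∷ xs) (p ∷ u) = All.++⁻ˡ xs p ∷ Unique-++⁻ˡ xs u

Unique-++⁻ʳ : (xs : List X) {ys : List X} → Unique (xs ++ ys) → Unique ys
Unique-++⁻ʳ []       u       = u
Unique-++⁻ʳ (_ ∷ xs) (_ ∷ u) = Unique-++⁻ʳ xs u

Unique-++-∈ : (xs : List X) {ys : List X} {v : X} → Unique (xs ++ ys) → v ∈ xs → All (v ≢_) ys
Unique-++-∈ (_ ∷ xs) (p ∷ _) (here refl) = All.++⁻ʳ xs p
Unique-++-∈ (_ ∷ xs) (_ ∷ u) (there v∈xs) = Unique-++-∈ xs u v∈xs

All-drop-middle : ∀ {p} {P : X → Set p} (xs ys : List X) {zs : List X} →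
                  All P (xs ++ ys ++ zs) → All P (xs ++ zs)
All-drop-middle xs ys h = All.++⁺ (All.++⁻ˡ xs h) (All.++⁻ʳ ys (All.++⁻ʳ xs h))

Unique-drop-middle : (xs ys : List X) {zs : List X} → Unique (xs ++ ys ++ zs) → Unique (xs ++ zs)
Unique-drop-middle []       ys u       = Unique-++⁻ʳ ys u
Unique-drop-middle (_ ∷ xs) ys (p ∷ u) = All-drop-middle xs ys p ∷ Unique-drop-middle xs ys u

Unique-drop-third : (ws xs ys zs : List X) → Unique (ws ++ xs ++ ys ++ zs) → Unique (ws ++ xs ++ zs)
Unique-drop-third ws xs ys zs u =
  subst Unique (++-assoc ws xs zs)
    (Unique-drop-middle (ws ++ xs) ys (subst Unique (sym (++-assoc ws xs (ys ++ zs))) u))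

length-insertAt : ∀ k (x : X) xs → length (insertAt k x xs) ≡ suc (length xs)
length-insertAt zero    x xs       = refl
length-insertAt (suc k) x []       = refl
length-insertAt (suc k) x (y ∷ xs) = cong suc (length-insertAt k x xs)

length-act : ∀ {n} (σ : Perm n) (xs : List X) → length (act σ xs) ≡ length xs
length-act {n = zero}  σ       xs       = refl
length-act {n = suc n} (i , σ) []       = refl
length-act {n = suc n} (i , σ) (x ∷ xs) =
  trans (length-insertAt (toℕ i) x (act σ xs)) (cong suc (length-act σ xs))

All-insertAt⁺ : ∀ {p} {P : X → Set p} k {x xs} → P x → All P xs → All P (insertAt k x xs)
All-insertAt⁺ zero    {xs = xs}     px h        = px ∷ h
All-insertAt⁺ (suc k) {xs = []}     px h        = px ∷ []
All-insertAt⁺ (suc k) {xs = y ∷ xs} px (py ∷ h) = py ∷ All-insertAt⁺ k px h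

All-act⁺ : ∀ {p} {P : X → Set p} {n} (σ : Perm n) {xs} → All P xs → All P (act σ xs)
All-act⁺ {n = zero}  σ       h        = h
All-act⁺ {n = suc n} (i , σ) []       = []
All-act⁺ {n = suc n} (i , σ) (px ∷ h) = All-insertAt⁺ (toℕ i) px (All-act⁺ σ h)

Unique-insertAt⁺ : ∀ k {x : X} {xs} → All (x ≢_) xs → Unique xs → Unique (insertAt k x xs)
Unique-insertAt⁺ zero    {xs = xs}     x∉xs u = x∉xs ∷ u
Unique-insertAt⁺ (suc k) {xs = []}     x∉xs u = [] ∷ []
Unique-insertAt⁺ (suc k) {xs = y ∷ xs} (x≢y ∷ x∉xs) (y∉xs ∷ u) =
  All-insertAt⁺ k (λ y≡x → x≢y (sym y≡x)) y∉xs ∷ Unique-insertAt⁺ k x∉xs u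

Unique-act⁺ : ∀ {n} (σ : Perm n) {xs : List X} → Unique xs → Unique (act σ xs)
Unique-act⁺ {n = zero}  σ       u              = u
Unique-act⁺ {n = suc n} (i , σ) []            = []
Unique-act⁺ {n = suc n} (i , σ) (x∉xs ∷ u) =
  Unique-insertAt⁺ (toℕ i) (All-act⁺ σ x∉xs) (Unique-act⁺ σ u)

insertAt-map : (f : X → Y) → ∀ k x xs → insertAt k (f x) (map f xs) ≡ map f (insertAt k x xs)
insertAt-map f zero    x xs       = refl
insertAt-map f (suc k) x []       = refl
insertAt-map f (suc k) x (y ∷ xs) = cong (f y ∷_) (insertAt-map f k x xs)

act-map : (f : X → Y) → ∀ {n} (σ : Perm n) xs → act σ (map f xs) ≡ map f (act σ xs)
act-map f {zero}  σ       xs       = refl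
act-map f {suc n} (i , σ) []       = refl
act-map f {suc n} (i , σ) (x ∷ xs) =
  trans (cong (insertAt (toℕ i) (f x)) (act-map f σ xs)) (insertAt-map f (toℕ i) x (act σ xs))

module SyntaxProperties (L : Language) where
  open Language L
  open Syntax L

  lookup-here : ∀ v ys s ss → lookupVar v (v ∷ ys) (s ∷ ss) ≡ s
  lookup-here v ys s ss with v ≟ v
  ... | yes _   = refl
  ... | no v≢v = ⊥-elim (v≢v refl)

  lookup-there : ∀ v {y} ys s ss → v ≢ y → lookupVar v (y ∷ ys) (s ∷ ss) ≡ lookupVar v ys ss
  lookup-there v {y} ys s ss v≢y with v ≟ y
  ... | yes v≡y = ⊥-elim (v≢y v≡y)
  ... | no _    = refl

  lookup-self : ∀ v ys → lookupVar v ys (vars ys) ≡ var v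
  lookup-self v []       = refl
  lookup-self v (y ∷ ys) with v ≟ y
  ... | yes v≡y = cong var (sym v≡y)
  ... | no _    = lookup-self v ys

  lookup-∷-cong : ∀ v y s {ys ss ys' ss'} →
                  (∀ w → lookupVar w ys ss ≡ lookupVar w ys' ss') →
                  lookupVar v (y ∷ ys) (s ∷ ss) ≡ lookupVar v (y ∷ ys') (s ∷ ss')
  lookup-∷-cong v y s h with v ≟ y
  ... | yes _ = refl
  ... | no  _ = h v

  lookup-swap : ∀ v {y y'} ys s s' ss → y ≢ y' →
                lookupVar v (y' ∷ y ∷ ys) (s' ∷ s ∷ ss) ≡ lookupVar v (y ∷ y' ∷ ys) (s ∷ s' ∷ ss)
  lookup-swap v {y} {y'} ys s s' ss y≢y' with v ≟ y' | v ≟ y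
  ... | yes refl | yes refl = ⊥-elim (y≢y' refl)
  ... | yes refl | no  _    = sym (lookup-here v ys s' ss)
  ... | no  _    | yes refl = lookup-here v ys s ss
  ... | no v≢y'  | no v≢y   =
    trans (lookup-there v ys s ss v≢y) (sym (lookup-there v ys s' ss v≢y'))

  lookup-++-hit : ∀ {v} ys₁ {ys₂} ss₁ {ss₂} → v ∈ ys₁ → length ys₁ ≡ length ss₁ →
                  lookupVar v (ys₁ ++ ys₂) (ss₁ ++ ss₂) ≡ lookupVar v ys₁ ss₁
  lookup-++-hit {v} (y ∷ ys₁) (s ∷ ss₁) v∈ e with v ≟ y
  ... | yes _   = refl
  ... | no v≢y = lookup-++-hit ys₁ ss₁ (tail v≢y v∈) (suc-injective e)

  lookup-++-miss : ∀ {v} ys₁ {ys₂} ss₁ {ss₂} → All (v ≢_) ys₁ → length ys₁ ≡ length ss₁ →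
                   lookupVar v (ys₁ ++ ys₂) (ss₁ ++ ss₂) ≡ lookupVar v ys₂ ss₂
  lookup-++-miss []        []        []           _ = refl
  lookup-++-miss {v} (y ∷ ys₁) (s ∷ ss₁) (v≢y ∷ v∉) e =
    trans (lookup-there v (ys₁ ++ _) s (ss₁ ++ _) v≢y) (lookup-++-miss ys₁ ss₁ v∉ (suc-injective e))

  lookup-insertAt : ∀ k {y} s ys ss → length ys ≡ length ss → All (y ≢_) ys →
                    ∀ v → lookupVar v (insertAt k y ys) (insertAt k s ss) ≡ lookupVar v (y ∷ ys) (s ∷ ss)
  lookup-insertAt zero    s ys        ss        _ _ v = refl
  lookup-insertAt (suc k) s []        []        _ _ v = refl
  lookup-insertAt (suc k) s (y' ∷ ys) (s' ∷ ss) e (y≢y' ∷ y∉) v =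
    trans (lookup-∷-cong v y' s' (lookup-insertAt k s ys ss (suc-injective e) y∉))
          (lookup-swap v ys s s' ss y≢y')

  lookup-act : ∀ {n} (σ : Perm n) ys ss → Unique ys → length ys ≡ length ss →
               ∀ v → lookupVar v (act σ ys) (act σ ss) ≡ lookupVar v ys ss
  lookup-act {zero}  σ       ys       ss       _          _ v = refl
  lookup-act {suc n} (i , σ) []       []       _          _ v = refl
  lookup-act {suc n} (i , σ) (y ∷ ys) (s ∷ ss) (y∉ys ∷ u) e v =
    trans (lookup-insertAt (toℕ i) s (act σ ys) (act σ ss) lengths (All-act⁺ σ y∉ys) v)
          (lookup-∷-cong v y s (lookup-act σ ys ss u (suc-injective e)))
    where
      lengths : length (act σ ys) ≡ length (act σ ss)
      lengths = trans (length-act σ ys) (trans (suc-injective e) (sym (length-act σ ss)))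

  lookup-vars-++ : ∀ ys {ys₂} ss₂ → Unique (ys ++ ys₂) →
                   ∀ v → lookupVar v (ys ++ ys₂) (vars ys ++ ss₂) ≡ lookupVar v ys₂ ss₂
  lookup-vars-++ ys {ys₂} ss₂ u v with v ∈? ys
  ... | yes v∈ys =
    trans (lookup-++-hit ys (vars ys) v∈ys (sym (len-vars ys)))
          (trans (lookup-self v ys) (sym (lookup-miss v ys₂ ss₂ (Unique-++-∈ ys u v∈ys))))
  ... | no v∉ys = lookup-++-miss ys (vars ys) (All.¬Any⇒All¬ ys v∉ys) (sym (len-vars ys))

  lookup-++-vars : ∀ ys ys₂ ss → length ys ≡ length ss →
                   ∀ v → lookupVar v (ys ++ ys₂) (ss ++ vars ys₂) ≡ lookupVar v ys ss
  lookup-++-vars ys ys₂ ss e v with v ∈? ys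
  ... | yes v∈ys = lookup-++-hit ys ss v∈ys e
  ... | no v∉ys =
    trans (lookup-++-miss ys ss v∉ys' e) (trans (lookup-self v ys₂) (sym (lookup-miss v ys ss v∉ys')))
    where v∉ys' = All.¬Any⇒All¬ ys v∉ys

  lookup-contract : ∀ (x₁ x x' x₂ : List Var) → Unique (x₁ ++ x ++ x' ++ x₂) → length x' ≡ length x →
                    ∀ v → lookupVar v (x₁ ++ x ++ x' ++ x₂) (vars x₁ ++ vars x ++ vars x ++ vars x₂)
                          ≡ lookupVar v x' (vars x)
  lookup-contract x₁ x x' x₂ u lx' v =
    trans (lookup-vars-++ x₁ _ u v)
    (trans (lookup-vars-++ x _ (Unique-++⁻ʳ x₁ u) v)
           (lookup-++-vars x' x₂ (vars x) (trans lx' (sym (len-vars x))) v))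

  mutual
    substA-cong : ∀ {ys ss ys' ss'} → (∀ v → lookupVar v ys ss ≡ lookupVar v ys' ss') →
                  ∀ a → substA ys ss a ≡ substA ys' ss' a
    substA-cong h (var v)    = h v
    substA-cong h (app f ts) = cong (app f) (substTs-cong h ts)

    substT-cong : ∀ {ys ss ys' ss'} → (∀ v → lookupVar v ys ss ≡ lookupVar v ys' ss') →
                  ∀ t → substT ys ss t ≡ substT ys' ss' t
    substT-cong h []       = refl
    substT-cong h (a ∷ as) = cong₂ _∷_ (substA-cong h a) (substT-cong h as)

    substTs-cong : ∀ {ys ss ys' ss'} → (∀ v → lookupVar v ys ss ≡ lookupVar v ys' ss') →
                   ∀ ts → substTs ys ss ts ≡ substTs ys' ss' ts
    substTs-cong h []       = refl
    substTs-cong h (t ∷ ts) = cong₂ _∷_ (substT-cong h t) (substTs-cong h ts)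

  mutual
    substA-identity : ∀ {ys ss} → (∀ v → lookupVar v ys ss ≡ var v) → ∀ a → substA ys ss a ≡ a
    substA-identity h (var v)    = h v
    substA-identity h (app f ts) = cong (app f) (substTs-identity h ts)

    substT-identity : ∀ {ys ss} → (∀ v → lookupVar v ys ss ≡ var v) → ∀ t → substT ys ss t ≡ t
    substT-identity h []       = refl
    substT-identity h (a ∷ as) = cong₂ _∷_ (substA-identity h a) (substT-identity h as)

    substTs-identity : ∀ {ys ss} → (∀ v → lookupVar v ys ss ≡ var v) → ∀ ts → substTs ys ss ts ≡ ts
    substTs-identity h []       = refl
    substTs-identity h (t ∷ ts) = cong₂ _∷_ (substT-identity h t) (substTs-identity h ts)

  substT-self : ∀ ys t → substT ys (vars ys) t ≡ t
  substT-self ys = substT-identity (λ v → lookup-self v ys)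

  substT-++ : ∀ ys ss t t' → substT ys ss (t ++ t') ≡ substT ys ss t ++ substT ys ss t'
  substT-++ ys ss []      t' = refl
  substT-++ ys ss (a ∷ t) t' = cong (substA ys ss a ∷_) (substT-++ ys ss t t')

  length-substT : ∀ ys ss t → length (substT ys ss t) ≡ length t
  length-substT ys ss []      = refl
  length-substT ys ss (a ∷ t) = cong suc (length-substT ys ss t)

  substT-rename : ∀ ys zs → Unique ys → length ys ≡ length zs → substT ys (vars zs) (vars ys) ≡ vars zs
  substT-rename ys zs u e =
    trans (substT-vars ys (vars zs) ys) (map-hit ys (vars zs) u (trans e (sym (len-vars zs))))

  substT-rename-++ : ∀ ys zs → Unique ys → length ys ≡ length zs →
                     substT ys (vars zs) (vars ys ++ vars ys) ≡ vars zs ++ vars zs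
  substT-rename-++ ys zs u e =
    trans (substT-++ ys (vars zs) (vars ys) (vars ys)) (cong₂ _++_ rename rename)
    where rename = substT-rename ys zs u e

  rename-genΔ : ∀ x A → length x ≡ length A →
                substT (gvars 0 A) (vars x) (vars (gvars 0 A) ++ vars (gvars 0 A)) ≡ vars x ++ vars x
  rename-genΔ x A l = substT-rename-++ (gvars 0 A) x (gvars-unique 0 A) (trans (gvars-len 0 A) (sym l))

  mutual
    Der-context : ∀ {x A t B} → Der x A t B → length x ≡ length A × Unique x
    Der-context (variables v a)  = refl , [] ∷ []
    Der-context (function f args u) = Args-length args , u
    Der-context (substitution D E) = Der-context D
    Der-context unit = refl , []
    Der-context (tensor {x = x} {A = A} D E u) =
      len-++ {x = x} {A = A} (Der-length D) (Der-length E) , u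
    Der-context (weaken w x₁ x₂ x₃ A₁ A₂ A₃ l₁ l₂ u D) =
      len-++ {x = x₁} {A = A₁} l₁
        (len-++ {x = x₂} {A = A₂} l₂ (length-++-cancelˡ x₁ A₁ (Der-length D) l₁)) , u
    Der-context (exchange' e {x = x} {A = A} σ D) =
      trans (length-act σ x) (trans (Der-length D) (sym (length-act σ A))) ,
      Unique-act⁺ σ (Der-unique D)
    Der-context (contract c x₁ x x' x₂ A₁ A A₂ l₁ l l' D) =
      len-++ {x = x₁} {A = A₁} l₁ (len-++ {x = x} {A = A} l
        (length-++-cancelˡ x' A
          (length-++-cancelˡ x A (length-++-cancelˡ x₁ A₁ (Der-length D) l₁) l) l')) ,
      Unique-drop-third x₁ x x' x₂ (Der-unique D)

    Der-length : ∀ {x A t B} → Der x A t B → length x ≡ length A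
    Der-length D = proj₁ (Der-context D)

    Der-unique : ∀ {x A t B} → Der x A t B → Unique x
    Der-unique D = proj₂ (Der-context D)

    Args-length : ∀ {bs xs As ts} → Args bs xs As ts → length xs ≡ length As
    Args-length [] = refl
    Args-length (_∷_ {x = x} {A = A} D args) = len-++ {x = x} {A = A} (Der-length D) (Args-length args)

  Der-body-length : ∀ {x A t B} → Der x A t B → length t ≡ length B
  Der-body-length (variables v a)     = refl
  Der-body-length (function f args u) = refl
  Der-body-length (substitution {y = y} {t = t} D E) =
    trans (length-substT y _ t) (Der-body-length E)
  Der-body-length unit                = refl
  Der-body-length (tensor {s = s} {B = B} D E u) =
    len-++ {x = s} {A = B} (Der-body-length D) (Der-body-length E)
  Der-body-length (weaken w x₁ x₂ x₃ A₁ A₂ A₃ l₁ l₂ u D) = Der-body-length D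
  Der-body-length (exchange' e σ D)   = Der-body-length D
  Der-body-length (contract c {t = t} x₁ x x' x₂ A₁ A A₂ l₁ l l' D) =
    trans (length-substT x' (vars x) t) (Der-body-length D)

  Args-tensor : ∀ {bs xs As ts} → Args bs xs As ts → Unique xs → Der xs As (concat ts) bs
  Args-tensor []                      u = unit
  Args-tensor (_∷_ {x = x} D args) u = tensor D (Args-tensor args (Unique-++⁻ʳ x u)) u

  Args-singletons : ∀ {bs xs As ts} → Args bs xs As ts → ts ≡ map [_] (concat ts)
  Args-singletons [] = refl
  Args-singletons (_∷_ {t = t} {ts = ts} D args) = singleton t (Der-body-length D)
    where
      singleton : ∀ t → length t ≡ 1 → t ∷ ts ≡ map [_] (t ++ concat ts)
      singleton (a ∷ []) _ = cong ([ a ] ∷_) (Args-singletons args)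

  argTms-vars : ∀ k B → argTms k B ≡ map [_] (vars (gvars k B))
  argTms-vars k []      = refl
  argTms-vars k (b ∷ B) = cong ([ var k ] ∷_) (argTms-vars (suc k) B)

  substTs-singletons : ∀ ys ss zs → substTs ys ss (map [_] (vars zs)) ≡ map [_] (substT ys ss (vars zs))
  substTs-singletons ys ss []       = refl
  substTs-singletons ys ss (z ∷ zs) = cong ([ lookupVar z ys ss ] ∷_) (substTs-singletons ys ss zs)

  genFun-body : ∀ f {xs As ts} (args : Args (dom f) xs As ts) (u : Unique xs) →
                substT (gvars 0 (dom f)) (concat ts) [ app f (argTms 0 (dom f)) ] ≡ [ app f ts ]
  genFun-body f {ts = ts} args u = cong (λ ts' → [ app f ts' ]) (begin
    substTs g (concat ts) (argTms 0 (dom f))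
      ≡⟨ cong (substTs g (concat ts)) (argTms-vars 0 (dom f)) ⟩
    substTs g (concat ts) (map [_] (vars g))
      ≡⟨ substTs-singletons g (concat ts) g ⟩
    map [_] (substT g (concat ts) (vars g))
      ≡⟨ cong (map [_]) (substT-vars g (concat ts) g) ⟩
    map [_] (map (λ v → lookupVar v g (concat ts)) g)
      ≡⟨ cong (map [_]) (map-hit g (concat ts) (gvars-unique 0 (dom f)) lengths) ⟩
    map [_] (concat ts)
      ≡⟨ sym (Args-singletons args) ⟩
    ts ∎)
    where
      open ≡-Reasoning
      g = gvars 0 (dom f)
      lengths : length g ≡ length (concat ts)
      lengths = trans (gvars-len 0 (dom f)) (sym (Der-body-length (Args-tensor args u)))

module MonoidalProperties {o ℓ e : Level} (C : MonoidalCategory o ℓ e) where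
  open MonoidalCategory C

  homSetoid : Obj → Obj → Setoid ℓ e
  homSetoid A B = record { Carrier = A ⇒ B ; _≈_ = _≈_ ; isEquivalence = equiv }

  module HomReasoning {A B : Obj} = SetoidReasoning (homSetoid A B)

  infixr 5 _○_
  _○_ : ∀ {A B} {f g h : A ⇒ B} → f ≈ g → g ≈ h → f ≈ h
  _○_ = Eq.trans

  infixr 4 _⟩⨾_ _⨾⟨_
  _⟩⨾_ : ∀ {A B C} {f f' : A ⇒ B} → f ≈ f' → (g : B ⇒ C) → f ⨾ g ≈ f' ⨾ g
  p ⟩⨾ g = ⨾-resp p Eq.refl

  _⨾⟨_ : ∀ {A B C} (f : A ⇒ B) {g g' : B ⇒ C} → g ≈ g' → f ⨾ g ≈ f ⨾ g'
  f ⨾⟨ p = ⨾-resp Eq.refl p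

  sym-assoc : ∀ {A B C D} {f : A ⇒ B} {g : B ⇒ C} {h : C ⇒ D} → f ⨾ (g ⨾ h) ≈ (f ⨾ g) ⨾ h
  sym-assoc = Eq.sym assoc

  pullˡ : ∀ {A B C D} {f : A ⇒ B} {g : B ⇒ C} {h : A ⇒ C} {k : C ⇒ D} →
          f ⨾ g ≈ h → f ⨾ g ⨾ k ≈ h ⨾ k
  pullˡ p = sym-assoc ○ (p ⟩⨾ _)

  cancelˡ : ∀ {A B C} {x : A ⇒ B} {y : B ⇒ A} {f g : B ⇒ C} →
            y ⨾ x ≈ id → x ⨾ f ≈ x ⨾ g → f ≈ g
  cancelˡ yx p =
    Eq.sym idˡ ○ (Eq.sym yx ⟩⨾ _) ○ assoc ○ (_ ⨾⟨ p) ○ sym-assoc ○ (yx ⟩⨾ _) ○ idˡ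

  cancelʳ : ∀ {A B C} {x : B ⇒ C} {y : C ⇒ B} {f g : A ⇒ B} →
            x ⨾ y ≈ id → f ⨾ x ≈ g ⨾ x → f ≈ g
  cancelʳ xy p =
    Eq.sym idʳ ○ (_ ⨾⟨ Eq.sym xy) ○ sym-assoc ○ (p ⟩⨾ _) ○ assoc ○ (_ ⨾⟨ xy) ○ idʳ

  ⨾-inverse : ∀ {A B C} {f : A ⇒ B} {f' : B ⇒ A} {g : B ⇒ C} {g' : C ⇒ B} →
              g ⨾ g' ≈ id → f ⨾ f' ≈ id → (f ⨾ g) ⨾ (g' ⨾ f') ≈ id
  ⨾-inverse gg' ff' = assoc ○ (_ ⨾⟨ (pullˡ gg' ○ idˡ)) ○ ff'

  square-transposeˡ : ∀ {A B C D} {a : A ⇒ B} {b : B ⇒ D} {c : A ⇒ C} {d : C ⇒ D}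
                        {b' : D ⇒ B} {c' : C ⇒ A} →
                      a ⨾ b ≈ c ⨾ d → b ⨾ b' ≈ id → c' ⨾ c ≈ id → c' ⨾ a ≈ d ⨾ b'
  square-transposeˡ p bb' c'c =
    Eq.sym idʳ ○ (_ ⨾⟨ Eq.sym bb') ○ sym-assoc ○
    ((assoc ○ (_ ⨾⟨ p) ○ sym-assoc ○ (c'c ⟩⨾ _) ○ idˡ) ⟩⨾ _)

  square-transposeʳ : ∀ {A B C D} {a : A ⇒ B} {b : B ⇒ D} {c : A ⇒ C} {d : C ⇒ D}
                        {a' : B ⇒ A} {d' : D ⇒ C} →
                      a ⨾ b ≈ c ⨾ d → a' ⨾ a ≈ id → d ⨾ d' ≈ id → b ⨾ d' ≈ a' ⨾ c
  square-transposeʳ p a'a dd' =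
    Eq.sym idˡ ○ (Eq.sym a'a ⟩⨾ _) ○ assoc ○
    (_ ⨾⟨ (sym-assoc ○ (p ⟩⨾ _) ○ assoc ○ (_ ⨾⟨ dd') ○ idʳ))

  id⊗-⨾ : ∀ {A B C D} {f : A ⇒ B} {g : B ⇒ C} → id {D} ⊗₁ (f ⨾ g) ≈ (id ⊗₁ f) ⨾ (id ⊗₁ g)
  id⊗-⨾ = ⊗-resp (Eq.sym idˡ) Eq.refl ○ ⊗-⨾

  ⊗id-⨾ : ∀ {A B C D} {f : A ⇒ B} {g : B ⇒ C} → (f ⨾ g) ⊗₁ id {D} ≈ (f ⊗₁ id) ⨾ (g ⊗₁ id)
  ⊗id-⨾ = ⊗-resp Eq.refl (Eq.sym idˡ) ○ ⊗-⨾

  ⊗-sequentialise : ∀ {A B C D} {f : A ⇒ B} {g : C ⇒ D} → f ⊗₁ g ≈ (id ⊗₁ g) ⨾ (f ⊗₁ id)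
  ⊗-sequentialise = ⊗-resp (Eq.sym idˡ) (Eq.sym idʳ) ○ ⊗-⨾

  ⊗-inverse : ∀ {A B C D} {f : A ⇒ B} {f' : B ⇒ A} {g : C ⇒ D} {g' : D ⇒ C} →
              f ⨾ f' ≈ id → g ⨾ g' ≈ id → (f ⊗₁ g) ⨾ (f' ⊗₁ g') ≈ id
  ⊗-inverse ff' gg' = Eq.sym ⊗-⨾ ○ ⊗-resp ff' gg' ○ ⊗-id

  I⊗-injective : ∀ {A B} {f g : A ⇒ B} → id {I} ⊗₁ f ≈ id ⊗₁ g → f ≈ g
  I⊗-injective p = cancelˡ unitˡ-iso₂ (Eq.sym unitˡ-nat ○ (p ⟩⨾ _) ○ unitˡ-nat)

  ⊗I-injective : ∀ {A B} {f g : A ⇒ B} → f ⊗₁ id {I} ≈ g ⊗₁ id → f ≈ g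
  ⊗I-injective p = cancelˡ unitʳ-iso₂ (Eq.sym unitʳ-nat ○ (p ⟩⨾ _) ○ unitʳ-nat)

  -- Kelly's consequences of the pentagon and triangle axioms.
  α-unitˡ : ∀ {A B} → α⇒ {I} {A} {B} ⨾ unitˡ⇒ ≈ unitˡ⇒ ⊗₁ id
  α-unitˡ {A} {B} = I⊗-injective (cancelˡ α-iso₂ (cancelˡ (⊗-inverse α-iso₂ idˡ) (begin
    (α⇒ ⊗₁ id) ⨾ α⇒ ⨾ (id ⊗₁ (α⇒ ⨾ unitˡ⇒))
      ≈⟨ _ ⨾⟨ (_ ⨾⟨ id⊗-⨾) ⟩
    (α⇒ ⊗₁ id) ⨾ α⇒ ⨾ (id ⊗₁ α⇒) ⨾ (id ⊗₁ unitˡ⇒)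
      ≈⟨ (_ ⨾⟨ sym-assoc) ○ sym-assoc ⟩
    ((α⇒ ⊗₁ id) ⨾ α⇒ ⨾ (id ⊗₁ α⇒)) ⨾ (id ⊗₁ unitˡ⇒)
      ≈⟨ (pentagon ⟩⨾ _) ○ assoc ⟩
    α⇒ ⨾ α⇒ ⨾ (id ⊗₁ unitˡ⇒)
      ≈⟨ _ ⨾⟨ (triangle ○ ⊗-resp Eq.refl (Eq.sym ⊗-id)) ⟩
    α⇒ ⨾ (unitʳ⇒ ⊗₁ (id ⊗₁ id))
      ≈⟨ Eq.sym α-nat ⟩
    ((unitʳ⇒ ⊗₁ id) ⊗₁ id) ⨾ α⇒
      ≈⟨ (⊗-resp (Eq.sym triangle) Eq.refl ○ ⊗id-⨾) ⟩⨾ _ ⟩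
    ((α⇒ ⊗₁ id) ⨾ ((id ⊗₁ unitˡ⇒) ⊗₁ id)) ⨾ α⇒
      ≈⟨ assoc ○ (_ ⨾⟨ α-nat) ⟩
    (α⇒ ⊗₁ id) ⨾ α⇒ ⨾ (id ⊗₁ (unitˡ⇒ ⊗₁ id)) ∎)))
    where open HomReasoning

  α-unitʳ : ∀ {A B} → α⇒ {A} {B} {I} ⨾ (id ⊗₁ unitʳ⇒) ≈ unitʳ⇒
  α-unitʳ {A} {B} = ⊗I-injective (cancelʳ α-iso₁ (begin
    ((α⇒ ⨾ (id ⊗₁ unitʳ⇒)) ⊗₁ id) ⨾ α⇒
      ≈⟨ (⊗id-⨾ ⟩⨾ _) ○ assoc ○ (_ ⨾⟨ α-nat) ⟩
    (α⇒ ⊗₁ id) ⨾ α⇒ ⨾ (id ⊗₁ (unitʳ⇒ ⊗₁ id))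
      ≈⟨ _ ⨾⟨ (_ ⨾⟨ (⊗-resp Eq.refl (Eq.sym triangle) ○ id⊗-⨾)) ⟩
    (α⇒ ⊗₁ id) ⨾ α⇒ ⨾ (id ⊗₁ α⇒) ⨾ (id ⊗₁ (id ⊗₁ unitˡ⇒))
      ≈⟨ (_ ⨾⟨ sym-assoc) ○ sym-assoc ○ (pentagon ⟩⨾ _) ○ assoc ⟩
    α⇒ ⨾ α⇒ ⨾ (id ⊗₁ (id ⊗₁ unitˡ⇒))
      ≈⟨ _ ⨾⟨ Eq.sym α-nat ⟩
    α⇒ ⨾ ((id ⊗₁ id) ⊗₁ unitˡ⇒) ⨾ α⇒
      ≈⟨ _ ⨾⟨ (⊗-resp ⊗-id Eq.refl ⟩⨾ _) ⟩
    α⇒ ⨾ (id ⊗₁ unitˡ⇒) ⨾ α⇒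
      ≈⟨ sym-assoc ○ (triangle ⟩⨾ _) ⟩
    (unitʳ⇒ ⊗₁ id) ⨾ α⇒ ∎))
    where open HomReasoning

  unitˡ≈unitʳ : unitˡ⇒ {I} ≈ unitʳ⇒
  unitˡ≈unitʳ = ⊗I-injective (Eq.sym α-unitˡ ○ (α⇒ ⨾⟨ unitˡ-I⊗) ○ triangle)
    where
      unitˡ-I⊗ : unitˡ⇒ {I ⊗₀ I} ≈ id ⊗₁ unitˡ⇒
      unitˡ-I⊗ = Eq.sym (cancelʳ unitˡ-iso₁ unitˡ-nat)

module Classification {o ℓ e : Level} (L : Language) (C : MonoidalCategory o ℓ e) where
  open Language L
  open Syntax L
  open SyntaxProperties L
  open MonoidalCategory C
  open MonoidalProperties C
  open Semantics L C

  module PrestructureCoherence (M : Prestructure) where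
    open Prestructure M
    open Interp M

    split-merge : ∀ A B → split A B ⨾ merge A B ≈ id
    split-merge []      B = unitˡ-iso₂
    split-merge (a ∷ A) B =
      assoc ○ (_ ⨾⟨ (pullˡ α-iso₂ ○ idˡ)) ○ Eq.sym ⊗-⨾ ○ ⊗-resp idˡ (split-merge A B) ○ ⊗-id

    merge-split : ∀ A B → merge A B ⨾ split A B ≈ id
    merge-split []      B = unitˡ-iso₁
    merge-split (a ∷ A) B =
      assoc ○ (α⇒ ⨾⟨ (pullˡ (Eq.sym ⊗-⨾ ○ ⊗-resp idˡ (merge-split A B) ○ ⊗-id) ○ idˡ)) ○ α-iso₁

    interp-idDer : ∀ x A l u → interp (idDer x A l u) ≈ id
    interp-idDer []      []      _ _       = Eq.refl
    interp-idDer (v ∷ x) (a ∷ A) l (_ ∷ u) =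
      (_ ⨾⟨ ((⊗-resp Eq.refl (interp-idDer x A (suc-injective l) u) ○ ⊗-id) ⟩⨾ _)) ○
      (_ ⨾⟨ idˡ) ○ split-merge [ a ] A

    coe-∷ : ∀ {a A B} (p : A ≡ B) → coe ⟦_⟧ (cong (a ∷_) p) ≈ id ⊗₁ coe ⟦_⟧ p
    coe-∷ refl = Eq.sym ⊗-id

    merge-assoc : ∀ A B C → (merge A B ⊗₁ id) ⨾ merge (A ++ B) C ⨾ coe ⟦_⟧ (++-assoc A B C)
                            ≈ α⇒ ⨾ (id ⊗₁ merge B C) ⨾ merge A (B ++ C)
    merge-assoc [] B C = begin
      (unitˡ⇒ ⊗₁ id) ⨾ merge B C ⨾ id
        ≈⟨ (Eq.sym α-unitˡ ⟩⨾ _) ○ (_ ⨾⟨ idʳ) ⟩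
      (α⇒ ⨾ unitˡ⇒) ⨾ merge B C
        ≈⟨ assoc ○ (α⇒ ⨾⟨ Eq.sym unitˡ-nat) ⟩
      α⇒ ⨾ (id ⊗₁ merge B C) ⨾ unitˡ⇒ ∎
      where open HomReasoning
    merge-assoc (a ∷ A) B C = begin
      ((α⇒ ⨾ (id ⊗₁ mAB)) ⊗₁ id) ⨾ (α⇒ ⨾ (id ⊗₁ m)) ⨾ coe ⟦_⟧ (cong (a ∷_) (++-assoc A B C))
        ≈⟨ ⨾-resp ⊗id-⨾ (_ ⨾⟨ coe-∷ (++-assoc A B C)) ○ assoc ○ (_ ⨾⟨ (_ ⨾⟨ assoc)) ⟩
      (α⇒ ⊗₁ id) ⨾ ((id ⊗₁ mAB) ⊗₁ id) ⨾ α⇒ ⨾ (id ⊗₁ m) ⨾ (id ⊗₁ c)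
        ≈⟨ _ ⨾⟨ (sym-assoc ○ (α-nat ⟩⨾ _) ○ assoc) ⟩
      (α⇒ ⊗₁ id) ⨾ α⇒ ⨾ (id ⊗₁ (mAB ⊗₁ id)) ⨾ (id ⊗₁ m) ⨾ (id ⊗₁ c)
        ≈⟨ _ ⨾⟨ (_ ⨾⟨ ((_ ⨾⟨ Eq.sym id⊗-⨾) ○ Eq.sym id⊗-⨾ ○ ⊗-resp Eq.refl (merge-assoc A B C))) ⟩
      (α⇒ ⊗₁ id) ⨾ α⇒ ⨾ (id ⊗₁ (α⇒ ⨾ (id ⊗₁ merge B C) ⨾ merge A (B ++ C)))
        ≈⟨ (_ ⨾⟨ (_ ⨾⟨ (id⊗-⨾ ○ (_ ⨾⟨ id⊗-⨾)))) ○ (_ ⨾⟨ sym-assoc) ○ sym-assoc ⟩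
      ((α⇒ ⊗₁ id) ⨾ α⇒ ⨾ (id ⊗₁ α⇒)) ⨾ (id ⊗₁ (id ⊗₁ merge B C)) ⨾ (id ⊗₁ merge A (B ++ C))
        ≈⟨ (pentagon ⟩⨾ _) ○ assoc ⟩
      α⇒ ⨾ α⇒ ⨾ (id ⊗₁ (id ⊗₁ merge B C)) ⨾ (id ⊗₁ merge A (B ++ C))
        ≈⟨ α⇒ ⨾⟨ (sym-assoc ○ (Eq.sym α-nat ⟩⨾ _) ○ assoc) ⟩
      α⇒ ⨾ ((id ⊗₁ id) ⊗₁ merge B C) ⨾ α⇒ ⨾ (id ⊗₁ merge A (B ++ C))
        ≈⟨ α⇒ ⨾⟨ (⊗-resp ⊗-id Eq.refl ⟩⨾ _) ⟩
      α⇒ ⨾ (id ⊗₁ merge B C) ⨾ α⇒ ⨾ (id ⊗₁ merge A (B ++ C)) ∎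
      where
        open HomReasoning
        mAB : ⟦ A ⟧ ⊗₀ ⟦ B ⟧ ⇒ ⟦ A ++ B ⟧
        mAB = merge A B
        m : ⟦ A ++ B ⟧ ⊗₀ ⟦ C ⟧ ⇒ ⟦ (A ++ B) ++ C ⟧
        m = merge (A ++ B) C
        c : ⟦ (A ++ B) ++ C ⟧ ⇒ ⟦ A ++ B ++ C ⟧
        c = coe ⟦_⟧ (++-assoc A B C)

    merge-unitʳ : ∀ A → merge A [] ⨾ coe ⟦_⟧ (++-identityʳ A) ≈ unitʳ⇒
    merge-unitʳ []      = idʳ ○ unitˡ≈unitʳ
    merge-unitʳ (a ∷ A) =
      (_ ⨾⟨ coe-∷ (++-identityʳ A)) ○ assoc ○
      (α⇒ ⨾⟨ (Eq.sym id⊗-⨾ ○ ⊗-resp Eq.refl (merge-unitʳ A))) ○ α-unitʳ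

  module _ (M N : Prestructure) where
    private
      module M = Interp M
      module N = Interp N

    extend-merge : ∀ (h : ∀ a → Prestructure.obj M a ⇒ Prestructure.obj N a) A B →
                   M.merge A B ⨾ extend M N h (A ++ B) ≈ (extend M N h A ⊗₁ extend M N h B) ⨾ N.merge A B
    extend-merge h []      B = Eq.sym unitˡ-nat
    extend-merge h (a ∷ A) B =
      assoc ○ (α⇒ ⨾⟨ (Eq.sym ⊗-⨾ ○ ⊗-resp (idˡ ○ Eq.sym idʳ) (extend-merge h A B) ○ ⊗-⨾)) ○
      sym-assoc ○ (Eq.sym α-nat ⟩⨾ _) ○ assoc

    extend-resp : ∀ {h h' : ∀ a → Prestructure.obj M a ⇒ Prestructure.obj N a} →
                  (∀ a → h a ≈ h' a) → ∀ A → extend M N h A ≈ extend M N h' A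
    extend-resp p []      = Eq.refl
    extend-resp p (a ∷ A) = ⊗-resp (p a) (extend-resp p A)

  extend-id : ∀ M A → extend M M (λ a → id) A ≈ id
  extend-id M []      = Eq.refl
  extend-id M (a ∷ A) = ⊗-resp Eq.refl (extend-id M A) ○ ⊗-id

  extend-⨾ : ∀ M N P (h : ∀ a → Prestructure.obj M a ⇒ Prestructure.obj N a)
             (h' : ∀ a → Prestructure.obj N a ⇒ Prestructure.obj P a) A →
             extend M P (λ a → h a ⨾ h' a) A ≈ extend M N h A ⨾ extend N P h' A
  extend-⨾ M N P h h' []      = Eq.sym idˡ
  extend-⨾ M N P h h' (a ∷ A) = ⊗-resp Eq.refl (extend-⨾ M N P h h' A) ○ ⊗-⨾

  module EvalProperties (F : StrongMonoidal) where
    open StrongMonoidal F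
    open Eval F
    open Interp FG
    open PrestructureCoherence FG

    ψ-ψ⁻¹ : ∀ A → ψ A ⨾ ψ⁻¹ A ≈ id
    ψ-ψ⁻¹ []      = φ₀-iso₁
    ψ-ψ⁻¹ (a ∷ A) = ⨾-inverse (φ-iso₁ [ a ] A) (⊗-inverse idˡ (ψ-ψ⁻¹ A))

    ψ⁻¹-ψ : ∀ A → ψ⁻¹ A ⨾ ψ A ≈ id
    ψ⁻¹-ψ []      = φ₀-iso₂
    ψ⁻¹-ψ (a ∷ A) = ⨾-inverse (⊗-inverse idˡ (ψ⁻¹-ψ A)) (φ-iso₂ [ a ] A)

    ψ-merge : ∀ A B → merge A B ⨾ ψ (A ++ B) ≈ (ψ A ⊗₁ ψ B) ⨾ φ A B
    ψ-merge [] B = begin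
      unitˡ⇒ ⨾ ψ B
        ≈⟨ Eq.sym unitˡ-nat ⟩
      (id ⊗₁ ψ B) ⨾ unitˡ⇒
        ≈⟨ _ ⨾⟨ Eq.sym (φ-unitˡ B) ⟩
      (id ⊗₁ ψ B) ⨾ (φ₀ ⊗₁ id) ⨾ φ [] B
        ≈⟨ sym-assoc ○ (Eq.sym ⊗-sequentialise ⟩⨾ _) ⟩
      (φ₀ ⊗₁ ψ B) ⨾ φ [] B ∎
      where open HomReasoning
    ψ-merge (a ∷ A) B = begin
      (α⇒ ⨾ (id ⊗₁ merge A B)) ⨾ (id ⊗₁ ψ (A ++ B)) ⨾ φ [ a ] (A ++ B)
        ≈⟨ assoc ○ (_ ⨾⟨ (sym-assoc ○ (Eq.sym id⊗-⨾ ⟩⨾ _))) ⟩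
      α⇒ ⨾ (id ⊗₁ (merge A B ⨾ ψ (A ++ B))) ⨾ φ [ a ] (A ++ B)
        ≈⟨ _ ⨾⟨ (((⊗-resp Eq.refl (ψ-merge A B) ○ id⊗-⨾) ⟩⨾ _) ○ assoc) ⟩
      α⇒ ⨾ (id ⊗₁ (ψ A ⊗₁ ψ B)) ⨾ (id ⊗₁ φ A B) ⨾ φ [ a ] (A ++ B)
        ≈⟨ sym-assoc ○ (Eq.sym α-nat ⟩⨾ _) ○ assoc ⟩
      ((id ⊗₁ ψ A) ⊗₁ ψ B) ⨾ α⇒ ⨾ (id ⊗₁ φ A B) ⨾ φ [ a ] (A ++ B)
        ≈⟨ _ ⨾⟨ Eq.sym ((_ ⨾⟨ Eq.sym idʳ) ○ φ-assoc [ a ] A B) ⟩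
      ((id ⊗₁ ψ A) ⊗₁ ψ B) ⨾ (φ [ a ] A ⊗₁ id) ⨾ φ (a ∷ A) B
        ≈⟨ sym-assoc ○ ((Eq.sym ⊗-⨾ ○ ⊗-resp Eq.refl idʳ) ⟩⨾ _) ⟩
      (((id ⊗₁ ψ A) ⨾ φ [ a ] A) ⊗₁ ψ B) ⨾ φ (a ∷ A) B ∎
      where open HomReasoning

    ψ-split : ∀ A B → ψ (A ++ B) ⨾ φ⁻¹ A B ≈ split A B ⨾ (ψ A ⊗₁ ψ B)
    ψ-split A B = square-transposeʳ (ψ-merge A B) (split-merge A B) (φ-iso₁ A B)

    ψ⁻¹-merge : ∀ A B → φ A B ⨾ ψ⁻¹ (A ++ B) ≈ (ψ⁻¹ A ⊗₁ ψ⁻¹ B) ⨾ merge A B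
    ψ⁻¹-merge A B =
      Eq.sym (square-transposeˡ (ψ-merge A B) (ψ-ψ⁻¹ (A ++ B)) (⊗-inverse (ψ⁻¹-ψ A) (ψ⁻¹-ψ B)))

    Square : ∀ A B → ⟦ A ⟧ ⇒ ⟦ B ⟧ → F₀ A ⇒ F₀ B → Set e
    Square A B f g = f ⨾ ψ B ≈ ψ A ⨾ g

    square-id : ∀ {A} → Square A A id id
    square-id = idˡ ○ Eq.sym idʳ

    square-⨾ : ∀ {A B C f g f' g'} → Square A B f g → Square B C f' g' → Square A C (f ⨾ f') (g ⨾ g')
    square-⨾ p q = assoc ○ (_ ⨾⟨ q) ○ sym-assoc ○ (p ⟩⨾ _) ○ assoc

    square-resp : ∀ {A B f g g'} → g ≈ g' → Square A B f g → Square A B f g'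
    square-resp q s = s ○ (_ ⨾⟨ q)

    square-⊗ : ∀ {A B C D f g f' g'} → Square A B f g → Square C D f' g' →
               Square (A ++ C) (B ++ D) (split A C ⨾ (f ⊗₁ f') ⨾ merge B D) (φ⁻¹ A C ⨾ (g ⊗₁ g') ⨾ φ B D)
    square-⊗ {A} {B} {C} {D} {f} {g} {f'} {g'} p q = begin
      (split A C ⨾ (f ⊗₁ f') ⨾ merge B D) ⨾ ψ (B ++ D)
        ≈⟨ assoc ○ (_ ⨾⟨ (assoc ○ (_ ⨾⟨ ψ-merge B D))) ⟩
      split A C ⨾ (f ⊗₁ f') ⨾ (ψ B ⊗₁ ψ D) ⨾ φ B D
        ≈⟨ _ ⨾⟨ (sym-assoc ○ ((Eq.sym ⊗-⨾ ○ ⊗-resp p q ○ ⊗-⨾) ⟩⨾ _) ○ assoc) ⟩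
      split A C ⨾ (ψ A ⊗₁ ψ C) ⨾ (g ⊗₁ g') ⨾ φ B D
        ≈⟨ sym-assoc ○ (Eq.sym (ψ-split A C) ⟩⨾ _) ○ assoc ⟩
      ψ (A ++ C) ⨾ φ⁻¹ A C ⨾ (g ⊗₁ g') ⨾ φ B D ∎
      where open HomReasoning

    F-cong : ∀ {A B} (s t : Term A B) → tvars s ≡ tvars t → body s ≡ body t → F₁ s ≈ F₁ t
    F-cong {A} s t p q = F-resp (gvars 0 A , gvars-unique 0 A , gvars-len 0 A ,
                                 cong₂ (λ x b → substT x (vars (gvars 0 A)) b) p q)

    F-tensor : ∀ {A B C D} (s : Term A B) (t : Term C D) u →
               F₁ (tensorT s t u) ≈ φ⁻¹ A C ⨾ (F₁ s ⊗₁ F₁ t) ⨾ φ B D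
    F-tensor {A} {C = C} s t u = Eq.sym ((_ ⨾⟨ φ-natural s t u) ○ pullˡ (φ-iso₂ A C) ○ idˡ)

    idT : ∀ x A → length x ≡ length A → Unique x → Term A A
    idT x A l u = term x (vars x) (idDer x A l u)

    F-idT : ∀ x A l u → F₁ (idT x A l u) ≈ id
    F-idT x A l u = F-id x (idDer x A l u)

    castCod : ∀ {A B B'} → B ≡ B' → Term A B → Term A B'
    castCod {A} p t = term (tvars t) (body t) (subst (Der (tvars t) A (body t)) p (der t))

    F-castCod : ∀ {A B B'} (p : B ≡ B') (t : Term A B) → F₁ (castCod p t) ≈ F₁ t ⨾ coe F₀ p
    F-castCod refl t = Eq.sym idʳ

    weakArrF : T weakening → ∀ A₁ A₂ A₃ → F₀ (A₁ ++ A₂ ++ A₃) ⇒ F₀ (A₁ ++ A₃)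
    weakArrF w A₁ A₂ A₃ =
      φ⁻¹ A₁ (A₂ ++ A₃) ⨾ (id ⊗₁ (φ⁻¹ A₂ A₃ ⨾ (F₁ (genπ w A₂) ⊗₁ id) ⨾ φ [] A₃)) ⨾ φ A₁ A₃

    ΔBlockF : T contraction → ∀ A A₂ → F₀ (A ++ A₂) ⇒ F₀ (A ++ A ++ A₂)
    ΔBlockF c A A₂ = φ⁻¹ A A₂ ⨾ (F₁ (genΔ c A) ⊗₁ id) ⨾ φ (A ++ A) A₂ ⨾ coe F₀ (++-assoc A A A₂)

    contrArrF : T contraction → ∀ A₁ A A₂ → F₀ (A₁ ++ A ++ A₂) ⇒ F₀ (A₁ ++ A ++ A ++ A₂)
    contrArrF c A₁ A A₂ = φ⁻¹ A₁ (A ++ A₂) ⨾ (id ⊗₁ ΔBlockF c A A₂) ⨾ φ A₁ (A ++ A ++ A₂)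

    -- Each structural rule is a substitution of the premise into a tensor of identities with π, σ or Δ.
    F-weaken : ∀ w x₁ x₂ x₃ A₁ A₂ A₃ l₁ l₂ u {t B} (D : Der (x₁ ++ x₃) (A₁ ++ A₃) t B) →
               F₁ (term _ _ (weaken w x₁ x₂ x₃ A₁ A₂ A₃ l₁ l₂ u D))
               ≈ weakArrF w A₁ A₂ A₃ ⨾ F₁ (term _ _ D)
    F-weaken w x₁ x₂ x₃ A₁ A₂ A₃ l₁ l₂ u {t} D =
      F-cong _ (weakT ⨾T term _ _ D) refl (sym (substT-self (x₁ ++ x₃) t)) ○
      F-⨾ weakT (term _ _ D) ○ (F-weakT ⟩⨾ _)
      where
        u₂₃ = Unique-++⁻ʳ x₁ u
        u₁  = Unique-++⁻ˡ x₁ u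
        u₂  = Unique-++⁻ˡ x₂ u₂₃
        u₃  = Unique-++⁻ʳ x₂ u₂₃
        l₃  = length-++-cancelˡ x₁ A₁ (Der-length D) l₁
        weakT : Term (A₁ ++ A₂ ++ A₃) (A₁ ++ A₃)
        weakT = term (x₁ ++ x₂ ++ x₃) (vars (x₁ ++ x₃)) (weaken w x₁ x₂ x₃ A₁ A₂ A₃ l₁ l₂ u
              (idDer (x₁ ++ x₃) (A₁ ++ A₃) (Der-length D) (Der-unique D)))
        πT : Term A₂ []
        πT = term x₂ []
          (Der-cast (++-identityʳ x₂) (++-identityʳ A₂) refl refl
            (weaken w [] x₂ [] [] A₂ [] refl l₂ (subst Unique (sym (++-identityʳ x₂)) u₂) unit))
        F-πT : F₁ πT ≈ F₁ (genπ w A₂)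
        F-πT = F-resp (gvars 0 A₂ , gvars-unique 0 A₂ , gvars-len 0 A₂ , refl)
        F-weakT : F₁ weakT ≈ weakArrF w A₁ A₂ A₃
        F-weakT = F-cong weakT (tensorT (idT x₁ A₁ l₁ u₁) (tensorT πT (idT x₃ A₃ l₃ u₃) u₂₃) u)
                     refl (map-++ var x₁ x₃) ○
              F-tensor _ _ u ○
              (_ ⨾⟨ (⊗-resp (F-idT x₁ A₁ l₁ u₁)
                       (F-tensor _ _ u₂₃ ○ (_ ⨾⟨ (⊗-resp F-πT (F-idT x₃ A₃ l₃ u₃) ⟩⨾ _))) ⟩⨾ _))

    F-exchange : ∀ ex {x A t B} (σ : Perm (length A)) (D : Der x A t B) →
                 F₁ (term _ _ (exchange' ex σ D)) ≈ F₁ (genσ ex A σ) ⨾ F₁ (term _ _ D)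
    F-exchange ex {x} {A} {t} σ D =
      F-cong _ (σT ⨾T term _ _ D) refl (sym (substT-self x t)) ○ F-⨾ σT (term _ _ D) ○ (F-σT ⟩⨾ _)
      where
        g = gvars 0 A
        σT : Term (act σ A) A
        σT = term (act σ x) (vars x) (exchange' ex σ (idDer x A (Der-length D) (Der-unique D)))
        renamed : substT (act σ x) (vars (act σ g)) (vars x) ≡ substT (act σ g) (vars (act σ g)) (vars g)
        renamed = begin
          substT (act σ x) (vars (act σ g)) (vars x)
            ≡⟨ substT-vars (act σ x) (vars (act σ g)) x ⟩
          map (λ v → lookupVar v (act σ x) (vars (act σ g))) x
            ≡⟨ cong (λ ss → map (λ v → lookupVar v (act σ x) ss) x) (sym (act-map var σ g)) ⟩
          map (λ v → lookupVar v (act σ x) (act σ (vars g))) x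
            ≡⟨ map-cong (lookup-act σ x (vars g) (Der-unique D) lengths) x ⟩
          map (λ v → lookupVar v x (vars g)) x
            ≡⟨ map-hit x (vars g) (Der-unique D) lengths ⟩
          vars g
            ≡⟨ sym (substT-self (act σ g) (vars g)) ⟩
          substT (act σ g) (vars (act σ g)) (vars g) ∎
          where
            open ≡-Reasoning
            lengths : length x ≡ length (vars g)
            lengths = trans (Der-length D) (trans (sym (gvars-len 0 A)) (sym (len-vars g)))
        F-σT : F₁ σT ≈ F₁ (genσ ex A σ)
        F-σT = F-resp (act σ g , Unique-act⁺ σ (gvars-unique 0 A) ,
                      trans (length-act σ g) (trans (gvars-len 0 A) (sym (length-act σ A))) , renamed)

    genΔ-at : T contraction → ∀ x A → length x ≡ length A → Unique x → Term A (A ++ A)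
    genΔ-at c x A l u = term x (vars x ++ vars x)
      (Der-cast refl refl (rename-genΔ x A l) refl (substitution (idDer x A l u) (der (genΔ c A))))

    F-genΔ-at : ∀ c x A l u → F₁ (genΔ-at c x A l u) ≈ F₁ (genΔ c A)
    F-genΔ-at c x A l u =
      F-cong _ (idT x A l u ⨾T genΔ c A) refl (sym (rename-genΔ x A l)) ○ F-⨾ _ _ ○
      (F-idT x A l u ⟩⨾ _) ○ idˡ

    F-contract : ∀ c x₁ x x' x₂ A₁ A A₂ l₁ l l' {t B}
                   (D : Der (x₁ ++ x ++ x' ++ x₂) (A₁ ++ A ++ A ++ A₂) t B) →
                 F₁ (term _ _ (contract c x₁ x x' x₂ A₁ A A₂ l₁ l l' D))
                 ≈ contrArrF c A₁ A A₂ ⨾ F₁ (term _ _ D)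
    F-contract c x₁ x x' x₂ A₁ A A₂ l₁ l l' {t} D =
      F-cong _ (contrT ⨾T term _ _ D) refl body-eq ○ F-⨾ contrT (term _ _ D) ○ (F-contrT ⟩⨾ _)
      where
        u    = Unique-drop-third x₁ x x' x₂ (Der-unique D)
        uxx₂ = Unique-++⁻ʳ x₁ u
        u₁   = Unique-++⁻ˡ x₁ u
        ux   = Unique-++⁻ˡ x uxx₂
        u₂   = Unique-++⁻ʳ x uxx₂
        l₂   = length-++-cancelˡ x' A
                 (length-++-cancelˡ x A (length-++-cancelˡ x₁ A₁ (Der-length D) l₁) l) l'
        ΔBlockT : Term (A ++ A₂) (A ++ A ++ A₂)
        ΔBlockT = castCod (++-assoc A A A₂) (tensorT (genΔ-at c x A l ux) (idT x₂ A₂ l₂ u₂) uxx₂)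
        F-ΔBlockT : F₁ ΔBlockT ≈ ΔBlockF c A A₂
        F-ΔBlockT = F-castCod (++-assoc A A A₂) _ ○
                ((F-tensor _ _ uxx₂ ○ (_ ⨾⟨ (⊗-resp (F-genΔ-at c x A l ux) (F-idT x₂ A₂ l₂ u₂) ⟩⨾ _)))
                  ⟩⨾ _) ○
                assoc ○ (_ ⨾⟨ assoc)
        contrT-tensor : Term (A₁ ++ A ++ A₂) (A₁ ++ A ++ A ++ A₂)
        contrT-tensor = tensorT (idT x₁ A₁ l₁ u₁) ΔBlockT u
        reassoc : vars x₁ ++ vars x ++ vars x ++ vars x₂ ≡ vars x₁ ++ ((vars x ++ vars x) ++ vars x₂)
        reassoc = cong (vars x₁ ++_) (sym (++-assoc (vars x) (vars x) (vars x₂)))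
        contrT : Term (A₁ ++ A ++ A₂) (A₁ ++ A ++ A ++ A₂)
        contrT = term (x₁ ++ x ++ x₂) (vars x₁ ++ vars x ++ vars x ++ vars x₂)
                  (Der-cast refl refl (sym reassoc) refl (der contrT-tensor))
        F-contrT : F₁ contrT ≈ contrArrF c A₁ A A₂
        F-contrT = F-cong contrT contrT-tensor refl reassoc ○ F-tensor _ _ u ○
               (_ ⨾⟨ (⊗-resp (F-idT x₁ A₁ l₁ u₁) F-ΔBlockT ⟩⨾ _))
        body-eq : substT x' (vars x) t ≡
                  substT (x₁ ++ x ++ x' ++ x₂) (vars x₁ ++ vars x ++ vars x ++ vars x₂) t
        body-eq = sym (substT-cong (lookup-contract x₁ x x' x₂ (Der-unique D) (trans l' (sym l))) t)

    ψ-merge₃ : ∀ A B C → α⇒ ⨾ (id ⊗₁ merge B C) ⨾ merge A (B ++ C) ⨾ ψ (A ++ B ++ C)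
                         ≈ ((ψ A ⊗₁ ψ B) ⊗₁ ψ C) ⨾ (φ A B ⊗₁ id) ⨾ φ (A ++ B) C ⨾ coe F₀ (++-assoc A B C)
    ψ-merge₃ A B C = begin
      α⇒ ⨾ (id ⊗₁ merge B C) ⨾ merge A (B ++ C) ⨾ ψ (A ++ B ++ C)
        ≈⟨ _ ⨾⟨ (_ ⨾⟨ ψ-merge A (B ++ C)) ⟩
      α⇒ ⨾ (id ⊗₁ merge B C) ⨾ (ψ A ⊗₁ ψ (B ++ C)) ⨾ φ A (B ++ C)
        ≈⟨ _ ⨾⟨ (sym-assoc ○ ((Eq.sym ⊗-⨾ ○ ⊗-resp (idˡ ○ Eq.sym idʳ) (ψ-merge B C) ○ ⊗-⨾) ⟩⨾ _) ○ assoc) ⟩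
      α⇒ ⨾ (ψ A ⊗₁ (ψ B ⊗₁ ψ C)) ⨾ (id ⊗₁ φ B C) ⨾ φ A (B ++ C)
        ≈⟨ sym-assoc ○ (Eq.sym α-nat ⟩⨾ _) ○ assoc ⟩
      ((ψ A ⊗₁ ψ B) ⊗₁ ψ C) ⨾ α⇒ ⨾ (id ⊗₁ φ B C) ⨾ φ A (B ++ C)
        ≈⟨ _ ⨾⟨ Eq.sym (φ-assoc A B C) ⟩
      ((ψ A ⊗₁ ψ B) ⊗₁ ψ C) ⨾ (φ A B ⊗₁ id) ⨾ φ (A ++ B) C ⨾ coe F₀ (++-assoc A B C) ∎
      where open HomReasoning

    square-fun : ∀ f → Square (dom f) [ cod f ] (Prestructure.fun FG f ⨾ unitʳ⇐) (F₁ (genFun f))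
    square-fun f =
      assoc ○ (_ ⨾⟨ ((_ ⨾⟨ ((_ ⨾⟨ Eq.sym idʳ) ○ φ-unitʳ [ cod f ])) ○ unitʳ-iso₂)) ○ idʳ

    square-π : ∀ w A → Square A [] (Prestructure.π FG w A) (F₁ (genπ w A))
    square-π w A = assoc ○ (_ ⨾⟨ (assoc ○ (_ ⨾⟨ φ₀-iso₂) ○ idʳ))

    square-σ : ∀ ex A σ → Square (act σ A) A (Prestructure.σ FG ex A σ) (F₁ (genσ ex A σ))
    square-σ ex A σ = assoc ○ (_ ⨾⟨ (assoc ○ (_ ⨾⟨ ψ⁻¹-ψ A) ○ idʳ))

    square-ΔBlock : ∀ c A A₂ →
                    Square (A ++ A₂) (A ++ A ++ A₂)
                      (split A A₂ ⨾ ((Prestructure.Δ FG c A ⨾ split A A) ⊗₁ id) ⨾ α⇒ ⨾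
                       (id ⊗₁ merge A A₂) ⨾ merge A (A ++ A₂))
                      (ΔBlockF c A A₂)
    square-ΔBlock c A A₂ = begin
      (split A A₂ ⨾ (Δ⨾split ⊗₁ id) ⨾ α⇒ ⨾ (id ⊗₁ merge A A₂) ⨾ merge A (A ++ A₂)) ⨾ ψ (A ++ A ++ A₂)
        ≈⟨ assoc ○ (_ ⨾⟨ (assoc ○ (_ ⨾⟨ (assoc ○ (_ ⨾⟨ assoc))))) ⟩
      split A A₂ ⨾ (Δ⨾split ⊗₁ id) ⨾ α⇒ ⨾ (id ⊗₁ merge A A₂) ⨾ merge A (A ++ A₂) ⨾ ψ (A ++ A ++ A₂)
        ≈⟨ _ ⨾⟨ (_ ⨾⟨ ψ-merge₃ A A A₂) ⟩
      split A A₂ ⨾ (Δ⨾split ⊗₁ id) ⨾ ((ψ A ⊗₁ ψ A) ⊗₁ ψ A₂) ⨾ (φ A A ⊗₁ id) ⨾ r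
        ≈⟨ _ ⨾⟨ ((_ ⨾⟨ sym-assoc) ○ sym-assoc ○
                 (((_ ⨾⟨ Eq.sym ⊗-⨾) ○ Eq.sym ⊗-⨾ ○ ⊗-resp Eq.refl (idˡ ○ idʳ)) ⟩⨾ _)) ⟩
      split A A₂ ⨾ ((Δ⨾split ⨾ (ψ A ⊗₁ ψ A) ⨾ φ A A) ⊗₁ ψ A₂) ⨾ r
        ≈⟨ _ ⨾⟨ (((⊗-resp Δ⨾split-ψ (Eq.sym idʳ) ○ ⊗-⨾) ⟩⨾ _) ○ assoc) ⟩
      split A A₂ ⨾ (ψ A ⊗₁ ψ A₂) ⨾ (F₁ (genΔ c A) ⊗₁ id) ⨾ r
        ≈⟨ sym-assoc ○ (Eq.sym (ψ-split A A₂) ⟩⨾ _) ○ assoc ⟩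
      ψ (A ++ A₂) ⨾ ΔBlockF c A A₂ ∎
      where
        open HomReasoning
        Δ⨾split : ⟦ A ⟧ ⇒ ⟦ A ⟧ ⊗₀ ⟦ A ⟧
        Δ⨾split = Prestructure.Δ FG c A ⨾ split A A
        r : F₀ (A ++ A) ⊗₀ F₀ A₂ ⇒ F₀ (A ++ A ++ A₂)
        r = φ (A ++ A) A₂ ⨾ coe F₀ (++-assoc A A A₂)
        Δ⨾split-ψ : Δ⨾split ⨾ (ψ A ⊗₁ ψ A) ⨾ φ A A ≈ ψ A ⨾ F₁ (genΔ c A)
        Δ⨾split-ψ =
          assoc ○ (_ ⨾⟨ (sym-assoc ○ (Eq.sym (ψ-split A A) ⟩⨾ _) ○ assoc ○ (_ ⨾⟨ φ-iso₂ A A) ○ idʳ)) ○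
          assoc ○ (_ ⨾⟨ (assoc ○ (_ ⨾⟨ ψ⁻¹-ψ (A ++ A)) ○ idʳ))

    square-weakArr : ∀ w A₁ A₂ A₃ →
                     Square (A₁ ++ A₂ ++ A₃) (A₁ ++ A₃) (weakArr w A₁ A₂ A₃) (weakArrF w A₁ A₂ A₃)
    square-weakArr w A₁ A₂ A₃ = square-⊗ square-id (square-⊗ (square-π w A₂) square-id)

    square-contrArr : ∀ c A₁ A A₂ →
                      Square (A₁ ++ A ++ A₂) (A₁ ++ A ++ A ++ A₂) (contrArr c A₁ A A₂) (contrArrF c A₁ A A₂)
    square-contrArr c A₁ A A₂ = square-⊗ square-id (square-ΔBlock c A A₂)

    mutual
      ψ-natural : ∀ {x A t B} (D : Der x A t B) → Square A B (interp D) (F₁ (term x t D))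
      ψ-natural (variables v a) = square-resp (Eq.sym (F-id [ v ] (variables v a))) square-id
      ψ-natural (function f args u) =
        square-resp (Eq.sym (F-cong _ (term _ _ (Args-tensor args u) ⨾T genFun f) refl
                                    (sym (genFun-body f args u)) ○ F-⨾ _ (genFun f)))
          (square-⨾ (ψ-natural-Args args u) (square-fun f))
      ψ-natural (substitution D E) =
        square-resp (Eq.sym (F-⨾ (term _ _ D) (term _ _ E))) (square-⨾ (ψ-natural D) (ψ-natural E))
      ψ-natural unit = square-resp (Eq.sym (F-id [] unit)) square-id
      ψ-natural (tensor D E u) =
        square-resp (Eq.sym (F-tensor (term _ _ D) (term _ _ E) u)) (square-⊗ (ψ-natural D) (ψ-natural E))
      ψ-natural (weaken w x₁ x₂ x₃ A₁ A₂ A₃ l₁ l₂ u D) =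
        square-resp (Eq.sym (F-weaken w x₁ x₂ x₃ A₁ A₂ A₃ l₁ l₂ u D))
          (square-⨾ (square-weakArr w A₁ A₂ A₃) (ψ-natural D))
      ψ-natural (exchange' ex {A = A} σ D) =
        square-resp (Eq.sym (F-exchange ex σ D)) (square-⨾ (square-σ ex A σ) (ψ-natural D))
      ψ-natural (contract c x₁ x x' x₂ A₁ A A₂ l₁ l l' D) =
        square-resp (Eq.sym (F-contract c x₁ x x' x₂ A₁ A A₂ l₁ l l' D))
          (square-⨾ (square-contrArr c A₁ A A₂) (ψ-natural D))

      ψ-natural-Args : ∀ {bs xs As ts} (args : Args bs xs As ts) (u : Unique xs) →
                       Square As bs (interpArgs args) (F₁ (term xs (concat ts) (Args-tensor args u)))
      ψ-natural-Args [] u = square-resp (Eq.sym (F-id [] unit)) square-id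
      ψ-natural-Args (_∷_ {x = x} D args) u =
        square-resp (Eq.sym (F-tensor (term _ _ D) (term _ _ (Args-tensor args u')) u))
          (square-⊗ (ψ-natural D) (ψ-natural-Args args u'))
        where u' = Unique-++⁻ʳ x u

    -- The right-hand side of ψ-natural depends only on the term, not on its derivation.
    FG-isStructure : IsStructure FG
    FG-isStructure {x} {A} {t} {B} D E = cancelʳ (ψ-ψ⁻¹ B)
      (ψ-natural D ○ (_ ⨾⟨ F-cong (term x t D) (term x t E) refl refl) ○ Eq.sym (ψ-natural E))

  open EvalProperties public using (ψ-ψ⁻¹; ψ⁻¹-ψ; ψ-merge; ψ⁻¹-merge; ψ-natural; FG-isStructure)

  module _ {F F' : StrongMonoidal} (k : MonoidalNT F F') where
    private
      module F  = StrongMonoidal F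
      module F' = StrongMonoidal F'
      module k  = MonoidalNT k
      open Eval F using (ψ)
      open Eval F' using () renaming (ψ to ψ')

    extend-evalMor-ψ : ∀ A → extend (evalObj F) (evalObj F') (evalMor k) A ⨾ ψ' A ≈ ψ A ⨾ k.η A
    extend-evalMor-ψ []      = idˡ ○ Eq.sym k.monoidal₀
    extend-evalMor-ψ (a ∷ A) =
      sym-assoc ○ ((Eq.sym ⊗-⨾ ○ ⊗-resp (idʳ ○ Eq.sym idˡ) (extend-evalMor-ψ A) ○ ⊗-⨾) ⟩⨾ _) ○ assoc ○
      (_ ⨾⟨ Eq.sym (k.monoidal [ a ] A)) ○ sym-assoc

    evalMor-isMorphism : IsMorphism (evalObj F) (evalObj F') (evalMor k)
    evalMor-isMorphism {x} {A} {t} {B} D = cancelʳ (ψ-ψ⁻¹ F' B) (begin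
      (h A ⨾ Interp.interp (evalObj F') D) ⨾ ψ' B
        ≈⟨ assoc ○ (_ ⨾⟨ ψ-natural F' D) ⟩
      h A ⨾ ψ' A ⨾ F'.F₁ (term x t D)
        ≈⟨ pullˡ (extend-evalMor-ψ A) ○ assoc ⟩
      ψ A ⨾ k.η A ⨾ F'.F₁ (term x t D)
        ≈⟨ _ ⨾⟨ k.natural (term x t D) ⟩
      ψ A ⨾ F.F₁ (term x t D) ⨾ k.η B
        ≈⟨ sym-assoc ○ (Eq.sym (ψ-natural F D) ⟩⨾ _) ○ assoc ⟩
      Interp.interp (evalObj F) D ⨾ ψ B ⨾ k.η B
        ≈⟨ (_ ⨾⟨ Eq.sym (extend-evalMor-ψ B)) ○ sym-assoc ⟩
      (Interp.interp (evalObj F) D ⨾ h B) ⨾ ψ' B ∎)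
      where
        open HomReasoning
        h : ∀ A → Interp.⟦_⟧ (evalObj F) A ⇒ Interp.⟦_⟧ (evalObj F') A
        h = extend (evalObj F) (evalObj F') (evalMor k)

  interp-cast : ∀ (M : Prestructure) {x A t t' B} (p : t ≡ t') (D : Der x A t B) →
                Interp.interp M (Der-cast refl refl p refl D) ≈ Interp.interp M D
  interp-cast M refl D = Eq.refl

  module _ (M : Structure) where
    open Structure M
    open Interp pre
    open PrestructureCoherence pre

    -- s[z/x] and t[z/y] are the same term, so the derivations substituting z into s and into t agree.
    interp-resp-≈T : ∀ {A B} (s t : Term A B) → s ≈T t → interp (der s) ≈ interp (der t)
    interp-resp-≈T {A} s t (z , uz , lz , eq) =
      Eq.sym idˡ ○ (Eq.sym (interp-idDer z A lz uz) ⟩⨾ _) ○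
      isStructure (substitution (idDer z A lz uz) (der s))
                  (Der-cast refl refl (sym eq) refl (substitution (idDer z A lz uz) (der t))) ○
      interp-cast pre (sym eq) _ ○ (interp-idDer z A lz uz ⟩⨾ _) ○ idˡ

    interpretation : StrongMonoidal
    interpretation = record
      { F₀        = ⟦_⟧
      ; F₁        = λ t → interp (der t)
      ; F-resp    = λ {_} {_} {s} {t} → interp-resp-≈T s t
      ; F-id      = λ {A} x D → isStructure D (idDer x A (Der-length D) (Der-unique D)) ○
                                interp-idDer x A (Der-length D) (Der-unique D)
      ; F-⨾       = λ s t → Eq.refl
      ; φ₀        = id
      ; φ₀⁻¹      = id
      ; φ₀-iso₁   = idˡ
      ; φ₀-iso₂   = idˡ
      ; φ         = merge
      ; φ⁻¹       = split
      ; φ-iso₁    = merge-split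
      ; φ-iso₂    = split-merge
      ; φ-natural = λ {A} {_} {C} s t u → Eq.sym (pullˡ (merge-split A C) ○ idˡ)
      ; φ-assoc   = merge-assoc
      ; φ-unitˡ   = λ A → (⊗-id ⟩⨾ _) ○ idˡ
      ; φ-unitʳ   = λ A → (⊗-id ⟩⨾ _) ○ idˡ ○ merge-unitʳ A
      }

  interpretation-mor : ∀ {M N : Structure} → Morphism (Structure.pre M) (Structure.pre N) →
                       MonoidalNT (interpretation M) (interpretation N)
  interpretation-mor {M} {N} h = record
    { η         = extend (Structure.pre M) (Structure.pre N) (Morphism.comp h)
    ; natural   = λ s → Morphism.isMorphism h (der s)
    ; monoidal  = extend-merge (Structure.pre M) (Structure.pre N) (Morphism.comp h)
    ; monoidal₀ = idˡ
    }

  Interpretation : Functor StrCat HomCat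
  Interpretation = record
    { F₀   = interpretation
    ; F₁   = λ {M} {N} h → interpretation-mor {M} {N} h
    ; resp = λ {M} {N} p → extend-resp (Structure.pre M) (Structure.pre N) p
    ; F-id = λ {M} → extend-id (Structure.pre M)
    ; F-⨾  = λ {M} {N} {P} h h' → extend-⨾ (Structure.pre M) (Structure.pre N) (Structure.pre P)
                                           (Morphism.comp h) (Morphism.comp h')
    }

  Evaluation : Functor HomCat StrCat
  Evaluation = Ev FG-isStructure evalMor-isMorphism

  module _ (M : Structure) where
    private
      pre : Prestructure
      pre = Structure.pre M
      F : StrongMonoidal
      F = interpretation M
      open Eval F using (ψ; ψ⁻¹)

    -- In the structure FG induced by F = interpretation M, each atomic type is interpreted as |a| ⊗ 1.
    extend-unitʳ⇒ : ∀ A → extend (evalObj F) pre (λ a → unitʳ⇒) A ≈ ψ A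
    extend-unitʳ⇒ []      = Eq.refl
    extend-unitʳ⇒ (a ∷ A) = ⊗-resp Eq.refl (extend-unitʳ⇒ A) ○ ⊗-sequentialise ○ (_ ⨾⟨ Eq.sym triangle)

    extend-unitʳ⇐ : ∀ A → extend pre (evalObj F) (λ a → unitʳ⇐) A ≈ ψ⁻¹ A
    extend-unitʳ⇐ A = cancelʳ (ψ-ψ⁻¹ F A) (begin
      extend pre (evalObj F) (λ a → unitʳ⇐) A ⨾ ψ A
        ≈⟨ _ ⨾⟨ Eq.sym (extend-unitʳ⇒ A) ⟩
      extend pre (evalObj F) (λ a → unitʳ⇐) A ⨾ extend (evalObj F) pre (λ a → unitʳ⇒) A
        ≈⟨ Eq.sym (extend-⨾ pre (evalObj F) pre (λ a → unitʳ⇐) (λ a → unitʳ⇒) A) ⟩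
      extend pre pre (λ a → unitʳ⇐ ⨾ unitʳ⇒) A
        ≈⟨ extend-resp pre pre (λ a → unitʳ-iso₂) A ○ extend-id pre A ⟩
      id
        ≈⟨ Eq.sym (ψ⁻¹-ψ F A) ⟩
      ψ⁻¹ A ⨾ ψ A ∎)
      where open HomReasoning

    unitʳ⇒-morphism : Morphism (evalObj F) pre
    unitʳ⇒-morphism = record
      { comp       = λ a → unitʳ⇒
      ; isMorphism = λ {_} {A} {_} {B} D →
          (extend-unitʳ⇒ A ⟩⨾ _) ○ Eq.sym (ψ-natural F D) ○ (_ ⨾⟨ Eq.sym (extend-unitʳ⇒ B)) }

    unitʳ⇐-morphism : Morphism pre (evalObj F)
    unitʳ⇐-morphism = record
      { comp       = λ a → unitʳ⇐
      ; isMorphism = λ {_} {A} {_} {B} D →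
          (extend-unitʳ⇐ A ⟩⨾ _) ○ square-transposeˡ (ψ-natural F D) (ψ-ψ⁻¹ F B) (ψ⁻¹-ψ F A) ○
          (_ ⨾⟨ Eq.sym (extend-unitʳ⇐ B)) }

  module _ (F : StrongMonoidal) where
    open Eval F using (ψ; ψ⁻¹)

    ψ⁻¹-monoidalNT : MonoidalNT F (interpretation (Functor.F₀ Evaluation F))
    ψ⁻¹-monoidalNT = record
      { η         = ψ⁻¹
      ; natural   = λ {A} {B} s → square-transposeˡ (ψ-natural F (der s)) (ψ-ψ⁻¹ F B) (ψ⁻¹-ψ F A)
      ; monoidal  = ψ⁻¹-merge F
      ; monoidal₀ = StrongMonoidal.φ₀-iso₁ F }

    ψ-monoidalNT : MonoidalNT (interpretation (Functor.F₀ Evaluation F)) F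
    ψ-monoidalNT = record
      { η         = ψ
      ; natural   = λ s → Eq.sym (ψ-natural F (der s))
      ; monoidal  = ψ-merge F
      ; monoidal₀ = idˡ }

  evaluation-isEquivalence : IsCatEquivalence Evaluation
  evaluation-isEquivalence = record
    { inverse = Interpretation
    ; unit = record
      { η       = ψ⁻¹-monoidalNT
      ; η⁻¹     = ψ-monoidalNT
      ; iso₁    = ψ⁻¹-ψ
      ; iso₂    = ψ-ψ⁻¹
      ; natural = λ {F} {F'} k A →
          Eq.sym (square-transposeˡ (extend-evalMor-ψ k A) (ψ-ψ⁻¹ F' A) (ψ⁻¹-ψ F A))
      }
    ; counit = record
      { η       = unitʳ⇒-morphism
      ; η⁻¹     = unitʳ⇐-morphism
      ; iso₁    = λ M a → unitʳ-iso₁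
      ; iso₂    = λ M a → unitʳ-iso₂
      ; natural = λ h a → unitʳ-nat
      }
    }

theorem4p2 : ∀ {o ℓ e : Level} (L : Language) (C : MonoidalCategory o ℓ e) →
    let open Semantics L C in
    Σ ((F : StrongMonoidal) → IsStructure (evalObj F)) λ str →
    Σ (∀ {F F' : StrongMonoidal} (k : MonoidalNT F F') →
         IsMorphism (evalObj F) (evalObj F') (evalMor k)) λ mor →
    IsCatEquivalence (Ev str mor)
theorem4p2 L C = FG-isStructure , evalMor-isMorphism , evaluation-isEquivalence
  where open Classification L C
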